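{- Let $m\in\{0\}\cup\mathbb N$ and let $E\subseteq\mathbb Z$ satisfy $E=-E=E+m\mathbb Z$. Then for $Q=(\mathbb N,\mathbb Z,m\mathbb Z,m\mathbb Z,m\mathbb Z,\mathbb Z\setminus E)$ the set $\mathcal R_Q=\{p\in\mathcal P^{\circ\bullet}\mid Z(\{p\})\leq Q\}$ is a category of two-colored partitions.
   Context: A two-colored partition $p$ consists of a lower row $R_L$ and an upper row $R_U$ (disjoint, possibly empty, finite totally ordered sets), a decomposition of $P_p=R_L\cup R_U$ into disjoint nonempty blocks, and a coloring of each point by $\circ$ or $\bullet$; $\mathcal P^{\circ\bullet}$ is the set of all such. Orientation: the cyclic order on $P_p$ agreeing with the order of $R_L$ on $R_L$, with the reverse order of $R_U$ on $R_U$, with the maximum of $R_U$ succeeding the maximum of $R_L$ and the minimum of $R_L$ succeeding the minimum of $R_U$; intervals $]\alpha,\beta[_p$, $]\alpha,\beta]_p$ for distinct $\alpha,\beta$ refer to this cyclic order. Normalized color: color for lower points, inverse color for upper points. $\sigma_p(S)$: number of normalized-white minus number of normalized-black points of $S$; $\Sigma(p)=\sigma_p(P_p)$. Color distance: $\delta_p(\alpha,\alpha)=\Sigma(p)$; for $\alpha\ne\beta$, $\delta_p(\alpha,\beta)=\sigma_p(]\alpha,\beta[_p)$ if their normalized colors differ and $\sigma_p(]\alpha,\beta]_p)$ if they agree. Blocks $B\neq B'$ cross if there are pairwise distinct $\alpha,\beta\in B$, $\alpha',\beta'\in B'$ appearing in the cyclic order in the order $\alpha,\alpha',\beta,\beta'$.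 For a set $\mathcal S$ of partitions: $F(\mathcal S)=\{|B|: p\in\mathcal S, B$ block of $p\}$; $V(\mathcal S)=\{\sigma_p(B): p\in\mathcal S,B$ block of $p\}$; $\Sigma(\mathcal S)=\{\Sigma(p):p\in\mathcal S\}$; $L(\mathcal S)$ (resp. $K(\mathcal S)$) is the set of $\delta_p(\alpha_1,\alpha_2)$ over $p\in\mathcal S$, blocks $B$ of $p$, $\alpha_1\neq\alpha_2\in B$ with $]\alpha_1,\alpha_2[_p\cap B=\emptyset$ and $\sigma_p(\{\alpha_1,\alpha_2\})\neq0$ (resp. $=0$); $X(\mathcal S)$ is the set of $\delta_p(\alpha_1,\alpha_2)$ over $p\in\mathcal S$, crossing blocks $B_1,B_2$ of $p$, $\alpha_1\in B_1,\alpha_2\in B_2$. $Z=(F,V,\Sigma,L,K,X)$ and $\leq$ is componentwise inclusion. $\mathbb N=\{1,2,\dots\}$; $E+m\mathbb Z=\{e+mz\}$. Category: A set $\mathcal C\subseteq\mathcal P^{\circ\bullet}$ is a category if it contains the empty partition, the two partitions with one lower and one upper point of the same color ($\circ$ or $\bullet$) forming one block, and the two partitions without upper points having two lower points colored $\bullet\circ$ resp. $\circ\bullet$ forming one block, and is closed under: tensor product (append the rows of the second partition to the right of those of the first); involution (exchange upper and lower rows); and composition $pp'$ of pairs $(p,p')$ where the upper row of $p$ and lower row of $p'$ have equal length and equal colors rank by rank, defined by taking the lower row of $p$ and the upper row of $p'$ as rows, identifying the upper row of $p$ with the lower row of $p'$, and letting the blocks be the nonempty intersections with the new point set of the classes of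 the equivalence relation generated by the blocks of $p$ and of $p'$. -}

module Defs where

open import Level using (0ℓ)
open import Data.Bool using (Bool; true; false; not; _∧_; _∨_; if_then_else_)
open import Data.Nat using (ℕ; zero; suc; _+_; _≤_; _<ᵇ_; _≤ᵇ_)
open import Data.Integer using (ℤ; +_; -_; _*_) renaming (_+_ to _+ℤ_)
open import Data.Fin using (Fin; toℕ; opposite; splitAt; _↑ˡ_; _↑ʳ_)
open import Data.Fin.Properties using () renaming (_≟_ to _≟F_)
open import Data.Sum using (_⊎_; inj₁; inj₂)
open import Data.Sum.Properties using (≡-dec)
open import Data.Product using (Σ; ∃; ∃-syntax; _×_; _,_)
open import Data.List using (List; []; _∷_; _++_; map; allFin; filter; length; foldr)
open import Data.List.Membership.Propositional using (_∈_)
open import Data.List.Relation.Unary.Unique.Propositional using (Unique)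
open import Data.Unit using (⊤; tt)
open import Data.Empty using (⊥)
open import Relation.Nullary using (¬_; does)
open import Relation.Binary using (Rel; IsEquivalence)
open import Relation.Binary.PropositionalEquality using (_≡_; _≢_; refl; sym; trans)
import Relation.Binary.Construct.On as On
open import Relation.Binary.Construct.Closure.Equivalence using (EqClosure)
import Relation.Binary.Construct.Closure.Equivalence as EqC
open import Function.Bundles using (_⇔_)

-- Colors: true = ∘ (white), false = ● (black).
-- Points of a partition with k lower and l upper points:
--   inj₁ i  = i-th lower point (i = 0 … k-1, left to right)
--   inj₂ j  = j-th upper point (j = 0 … l-1, left to right)
-- Blocks are the equivalence classes of an equivalence relation _~_.

Pt : ℕ → ℕ → Set
Pt k l = Fin k ⊎ Fin l

record Partition (k l : ℕ) : Set₁ where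
  field
    lowerCol : Fin k → Bool
    upperCol : Fin l → Bool
    _~_      : Rel (Pt k l) 0ℓ
    isEquiv  : IsEquivalence _~_

open Partition public

_≟P_ : ∀ {k l} (a b : Pt k l) → Relation.Nullary.Dec (a ≡ b)
_≟P_ = ≡-dec _≟F_ _≟F_

allPts : ∀ k l → List (Pt k l)
allPts k l = map inj₁ (Data.List.allFin k) ++ map inj₂ (Data.List.allFin l)

-- position in the cyclic order (lower row left to right, then the upper
-- row right to left, then back to the first lower point)
pos : ∀ {k l} → Pt k l → ℕ
pos {k} (inj₁ i) = toℕ i
pos {k} (inj₂ j) = k + toℕ (opposite j)

-- γ ∈ ]α,β[_p   and   γ ∈ ]α,β]_p  (meaningful for α ≠ β)
inOpen : ∀ {k l} → Pt k l → Pt k l → Pt k l → Bool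
inOpen a b g =
  if pos a <ᵇ pos b
  then ((pos a <ᵇ pos g) ∧ (pos g <ᵇ pos b))
  else ((pos a <ᵇ pos g) ∨ (pos g <ᵇ pos b))

inHalfOpen : ∀ {k l} → Pt k l → Pt k l → Pt k l → Bool
inHalfOpen a b g =
  if pos a <ᵇ pos b
  then ((pos a <ᵇ pos g) ∧ (pos g ≤ᵇ pos b))
  else ((pos a <ᵇ pos g) ∨ (pos g ≤ᵇ pos b))

normCol : ∀ {k l} → Partition k l → Pt k l → Bool
normCol p (inj₁ i) = lowerCol p i
normCol p (inj₂ j) = not (upperCol p j)

wt : ∀ {k l} → Partition k l → Pt k l → ℤ
wt p a = if normCol p a then + 1 else - (+ 1)

sumℤ : List ℤ → ℤ
sumℤ = foldr _+ℤ_ (+ 0)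

-- σ_p(S) for a list of points S (used for lists without repetitions)
σL : ∀ {k l} → Partition k l → List (Pt k l) → ℤ
σL p xs = sumℤ (map (wt p) xs)

σ : ∀ {k l} → Partition k l → (Pt k l → Bool) → ℤ
σ {k} {l} p S = σL p (filter (λ g → Data.Bool._≟_ (S g) true) (allPts k l))

Σp : ∀ {k l} → Partition k l → ℤ
Σp p = σ p (λ _ → true)

boolEq : Bool → Bool → Bool
boolEq x y = does (Data.Bool._≟_ x y)

δ : ∀ {k l} → Partition k l → Pt k l → Pt k l → ℤ
δ p a b with a ≟P b
... | Relation.Nullary.yes _ = Σp p
... | Relation.Nullary.no _ =
  if boolEq (normCol p a) (normCol p b)
  then σ p (inHalfOpen a b)
  else σ p (inOpen a b)

BlockList : ∀ {k l} → (p : Partition k l) → Pt k l → List (Pt k l) → Set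
BlockList p a xs = Unique xs × (∀ g → (g ∈ xs) ⇔ (_~_ p a g))

Cross : ∀ {k l} → (p : Partition k l) → Pt k l → Pt k l → Set
Cross p a a' =
  ¬ (_~_ p a a') ×
  ∃[ b ] ∃[ b' ] (_~_ p a b × _~_ p a' b' × a ≢ b × a' ≢ b' ×
     inOpen a b a' ≡ true × inOpen b a b' ≡ true)

-- The six sets Z({p}) = (F, V, Σ, L, K, X), as predicates.

FSet : ∀ {k l} → Partition k l → ℕ → Set
FSet p n = ∃[ a ] ∃[ xs ] (BlockList p a xs × length xs ≡ n)

VSet : ∀ {k l} → Partition k l → ℤ → Set
VSet p z = ∃[ a ] ∃[ xs ] (BlockList p a xs × σL p xs ≡ z)

ΣSet : ∀ {k l} → Partition k l → ℤ → Set
ΣSet p z = Σp p ≡ z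

Neighbours : ∀ {k l} → (p : Partition k l) → Pt k l → Pt k l → Set
Neighbours p a₁ a₂ =
  _~_ p a₁ a₂ × a₁ ≢ a₂ × (∀ g → inOpen a₁ a₂ g ≡ true → ¬ (_~_ p a₁ g))

LSet : ∀ {k l} → Partition k l → ℤ → Set
LSet p z = ∃[ a₁ ] ∃[ a₂ ] (Neighbours p a₁ a₂ ×
  σL p (a₁ ∷ a₂ ∷ []) ≢ + 0 × δ p a₁ a₂ ≡ z)

KSet : ∀ {k l} → Partition k l → ℤ → Set
KSet p z = ∃[ a₁ ] ∃[ a₂ ] (Neighbours p a₁ a₂ ×
  σL p (a₁ ∷ a₂ ∷ []) ≡ + 0 × δ p a₁ a₂ ≡ z)

XSet : ∀ {k l} → Partition k l → ℤ → Set
XSet p z = ∃[ c₁ ] ∃[ c₂ ] ∃[ a₁ ] ∃[ a₂ ] (Cross p c₁ c₂ ×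
  _~_ p c₁ a₁ × _~_ p c₂ a₂ × δ p a₁ a₂ ≡ z)

record Q6 : Set₁ where
  field
    QF : ℕ → Set
    QV : ℤ → Set
    QΣ : ℤ → Set
    QL : ℤ → Set
    QK : ℤ → Set
    QX : ℤ → Set
open Q6 public

_Z≤_ : ∀ {k l} → Partition k l → Q6 → Set
p Z≤ Q =
  (∀ n → FSet p n → QF Q n) ×
  (∀ z → VSet p z → QV Q z) ×
  (∀ z → ΣSet p z → QΣ Q z) ×
  (∀ z → LSet p z → QL Q z) ×
  (∀ z → KSet p z → QK Q z) ×
  (∀ z → XSet p z → QX Q z)

InMZ : ℕ → ℤ → Set
InMZ m z = ∃[ t ] z ≡ (+ m) * t

-- Q = (ℕ, ℤ, mℤ, mℤ, mℤ, ℤ \ E)   with ℕ = {1,2,…}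
Qm : ℕ → (ℤ → Set) → Q6
Qm m E = record
  { QF = λ n → 1 ≤ n
  ; QV = λ _ → ⊤
  ; QΣ = InMZ m
  ; QL = InMZ m
  ; QK = InMZ m
  ; QX = λ z → ¬ E z
  }

R : (Q : Q6) → ∀ {k l} → Partition k l → Set
R Q p = p Z≤ Q

sideP : ∀ {k₁ l₁ k₂ l₂} → Pt (k₁ + k₂) (l₁ + l₂) → Pt k₁ l₁ ⊎ Pt k₂ l₂
sideP {k₁} {l₁} (inj₁ i) with splitAt k₁ i
... | inj₁ i₁ = inj₁ (inj₁ i₁)
... | inj₂ i₂ = inj₂ (inj₁ i₂)
sideP {k₁} {l₁} (inj₂ j) with splitAt l₁ j
... | inj₁ j₁ = inj₁ (inj₂ j₁)
... | inj₂ j₂ = inj₂ (inj₂ j₂)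

data SumRel {A B : Set} (RA : Rel A 0ℓ) (RB : Rel B 0ℓ) : Rel (A ⊎ B) 0ℓ where
  ₁∼₁ : ∀ {x y} → RA x y → SumRel RA RB (inj₁ x) (inj₁ y)
  ₂∼₂ : ∀ {x y} → RB x y → SumRel RA RB (inj₂ x) (inj₂ y)

sumRel-isEquiv : ∀ {A B : Set} {RA : Rel A 0ℓ} {RB : Rel B 0ℓ} →
  IsEquivalence RA → IsEquivalence RB → IsEquivalence (SumRel RA RB)
sumRel-isEquiv {A} {B} {RA} {RB} eA eB = record { refl = r ; sym = s ; trans = t }
  where
  r : ∀ {x} → SumRel RA RB x x
  r {inj₁ x} = ₁∼₁ (IsEquivalence.refl eA)
  r {inj₂ x} = ₂∼₂ (IsEquivalence.refl eB)
  s : ∀ {x y} → SumRel RA RB x y → SumRel RA RB y x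
  s (₁∼₁ q) = ₁∼₁ (IsEquivalence.sym eA q)
  s (₂∼₂ q) = ₂∼₂ (IsEquivalence.sym eB q)
  t : ∀ {x y z} → SumRel RA RB x y → SumRel RA RB y z → SumRel RA RB x z
  t (₁∼₁ q) (₁∼₁ q') = ₁∼₁ (IsEquivalence.trans eA q q')
  t (₂∼₂ q) (₂∼₂ q') = ₂∼₂ (IsEquivalence.trans eB q q')

joinCol : ∀ {a b} → (Fin a → Bool) → (Fin b → Bool) → Fin (a + b) → Bool
joinCol {a} f g i with splitAt a i
... | inj₁ i₁ = f i₁
... | inj₂ i₂ = g i₂

_⊗_ : ∀ {k₁ l₁ k₂ l₂} → Partition k₁ l₁ → Partition k₂ l₂ →
      Partition (k₁ + k₂) (l₁ + l₂)
p ⊗ q = record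
  { lowerCol = joinCol (lowerCol p) (lowerCol q)
  ; upperCol = joinCol (upperCol p) (upperCol q)
  ; _~_ = λ x y → SumRel (_~_ p) (_~_ q) (sideP x) (sideP y)
  ; isEquiv = On.isEquivalence sideP (sumRel-isEquiv (isEquiv p) (isEquiv q))
  }

swapPt : ∀ {k l} → Pt l k → Pt k l
swapPt (inj₁ i) = inj₂ i
swapPt (inj₂ j) = inj₁ j

_* : ∀ {k l} → Partition k l → Partition l k
p * = record
  { lowerCol = upperCol p
  ; upperCol = lowerCol p
  ; _~_ = λ x y → _~_ p (swapPt x) (swapPt y)
  ; isEquiv = On.isEquivalence swapPt (isEquiv p)
  }

-- composition pq: p below (lower row k, upper row l), q above
-- (lower row l, upper row r); the middle row (Fin l) is identified.
MidPt : ℕ → ℕ → ℕ → Set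
MidPt k l r = Fin k ⊎ Fin l ⊎ Fin r

fromP : ∀ {k l r} → Pt k l → MidPt k l r
fromP (inj₁ i) = inj₁ i
fromP (inj₂ j) = inj₂ (inj₁ j)

fromQ : ∀ {k l r} → Pt l r → MidPt k l r
fromQ (inj₁ j) = inj₂ (inj₁ j)
fromQ (inj₂ i) = inj₂ (inj₂ i)

data CompEdge {k l r} (p : Partition k l) (q : Partition l r) :
       Rel (MidPt k l r) 0ℓ where
  edgeP : ∀ {x y} → _~_ p x y → CompEdge p q (fromP x) (fromP y)
  edgeQ : ∀ {x y} → _~_ q x y → CompEdge p q (fromQ x) (fromQ y)

outer : ∀ {k l r} → Pt k r → MidPt k l r
outer (inj₁ i) = inj₁ i
outer (inj₂ i) = inj₂ (inj₂ i)

compose : ∀ {k l r} → Partition k l → Partition l r → Partition k r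
compose p q = record
  { lowerCol = lowerCol p
  ; upperCol = upperCol q
  ; _~_ = λ x y → EqClosure (CompEdge p q) (outer x) (outer y)
  ; isEquiv = On.isEquivalence outer (EqC.isEquivalence (CompEdge p q))
  }

emptyP : Partition 0 0
emptyP = record
  { lowerCol = λ () ; upperCol = λ () ; _~_ = _≡_
  ; isEquiv = record { refl = refl ; sym = sym ; trans = trans } }

allOne : ∀ {A : Set} → IsEquivalence {A = A} (λ _ _ → ⊤)
allOne = record { refl = tt ; sym = λ _ → tt ; trans = λ _ _ → tt }

idP : Bool → Partition 1 1
idP c = record
  { lowerCol = λ _ → c ; upperCol = λ _ → c ; _~_ = λ _ _ → ⊤ ; isEquiv = allOne }

pairP : Bool → Bool → Partition 2 0
pairP c₀ c₁ = record
  { lowerCol = col ; upperCol = λ () ; _~_ = λ _ _ → ⊤ ; isEquiv = allOne }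
  where
  col : Fin 2 → Bool
  col Fin.zero = c₀
  col (Fin.suc _) = c₁

record IsCategory (C : ∀ {k l} → Partition k l → Set) : Set₁ where
  field
    hasEmpty : C emptyP
    hasId∘   : C (idP true)
    hasId●   : C (idP false)
    hasPair●∘ : C (pairP false true)
    hasPair∘● : C (pairP true false)
    tensorClosed : ∀ {k₁ l₁ k₂ l₂} (p : Partition k₁ l₁) (q : Partition k₂ l₂) →
      C p → C q → C (p ⊗ q)
    involClosed : ∀ {k l} (p : Partition k l) → C p → C (p *)
    compClosed : ∀ {k l r} (p : Partition k l) (q : Partition l r) →
      (∀ j → upperCol p j ≡ lowerCol q j) → C p → C q → C (compose p q)

-- The colour distance is a difference of heights: if height p a is σ of the points before a
-- (lowered by one when a is normalized black), then δ p a b = height b − height a up to a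
-- multiple of Σ(p). So Z({p}) ≤ Q says exactly that p is admissible: Σ(p) ∈ mℤ, the height is
-- constant mod m on every block (the L and K conditions between neighbours propagate along a
-- block), and the heights of crossing blocks differ by an element outside E, which is a union
-- of classes mod m closed under negation. Admissibility is checked directly for the
-- generators; tensor products and the involution shift heights by constants on each factor,
-- and a composition inherits heights from its factors. Crossing blocks of a composition would
-- give crossing chords inside one factor by a parity count along the two blocks.

module Submission where

open import Defs
open import Data.Nat using (ℕ)
open import Data.Integer using (ℤ; +_; -_; _+_; _*_)
open import Data.Product using (_×_; ∃-syntax)
open import Function.Bundles using (_⇔_)
open import Relation.Binary.PropositionalEquality using (_≡_)

open import Data.Bool using (Bool; true; false; not; _∧_; _∨_; _xor_; if_then_else_; T)
import Data.Bool.Properties as Boolₚ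
open import Data.Empty using (⊥; ⊥-elim)
open import Data.Fin as Fin using (Fin; toℕ; opposite; splitAt; _↑ˡ_; _↑ʳ_)
import Data.Fin.Properties as Finₚ
open import Data.Integer using (_-_)
import Data.Integer.Properties as ℤₚ
import Data.Integer.Divisibility.Signed as DS
open import Data.Integer.Tactic.RingSolver using (solve-∀)
import Data.Nat.Tactic.RingSolver as ℕSolver
import Tactic.RingSolver as BoolSolver
open import Tactic.RingSolver.Core.AlmostCommutativeRing using (AlmostCommutativeRing; fromCommutativeRing)
import Algebra.Properties.CommutativeSemigroup as CommSemigroupₚ
open import Data.List using (List; []; _∷_; _++_; map; allFin; filter; foldr)
import Data.List.Properties as Listₚ
open import Data.List.Membership.Propositional using (_∈_)
open import Data.List.Relation.Unary.Any using (here; there)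
open import Data.Maybe using (Maybe; just; nothing)
open import Data.Nat as ℕ using (zero; suc; _<ᵇ_; _≤ᵇ_; _≡ᵇ_; _<_; _≤_; _∸_; z≤n; s≤s)
import Data.Nat.Properties as ℕₚ
open import Data.Product using (_,_; proj₁; proj₂) renaming (map to map×)
open import Data.Sum using (_⊎_; inj₁; inj₂)
open import Data.Unit using (tt)
open import Function using (_∘_; case_of_)
open import Function.Bundles using (module Equivalence)
open import Relation.Binary using (IsEquivalence; tri<; tri≈; tri>)
open import Relation.Binary.Construct.Closure.Equivalence using (EqClosure)
import Relation.Binary.Construct.Closure.Equivalence as EqC
open import Relation.Binary.Construct.Closure.ReflexiveTransitive using (ε; _◅_; _◅◅_)
open import Relation.Binary.Construct.Closure.Symmetric using (fwd; bwd)
open import Relation.Binary.PropositionalEquality using (_≢_; refl; sym; trans; cong; cong₂; subst; subst₂; module ≡-Reasoning)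
open import Relation.Nullary using (¬_; Dec; yes; no)
open import Relation.Nullary.Decidable using (decidable-stable; ¬¬-excluded-middle)

open ≡-Reasoning

private
  module ℕ+ = CommSemigroupₚ ℕₚ.+-commutativeSemigroup
  module ℤ+ = CommSemigroupₚ ℤₚ.+-commutativeSemigroup

<ᵇ-true : ∀ {m n} → m < n → (m <ᵇ n) ≡ true
<ᵇ-true {m} {n} m<n with m <ᵇ n | ℕₚ.<⇒<ᵇ m<n
... | true | _ = refl

<ᵇ-false : ∀ {m n} → n ≤ m → (m <ᵇ n) ≡ false
<ᵇ-false {m} {n} n≤m with m <ᵇ n in eq
... | true = ⊥-elim (ℕₚ.≤⇒≯ n≤m (ℕₚ.<ᵇ⇒< m n (subst T (sym eq) tt)))
... | false = refl

<ᵇ-true⇒< : ∀ {m n} → (m <ᵇ n) ≡ true → m < n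
<ᵇ-true⇒< {m} {n} eq = ℕₚ.<ᵇ⇒< m n (subst T (sym eq) tt)

≡ᵇ-refl : ∀ m → (m ≡ᵇ m) ≡ true
≡ᵇ-refl zero = refl
≡ᵇ-refl (suc m) = ≡ᵇ-refl m

≡ᵇ-false : ∀ {m n} → m ≢ n → (m ≡ᵇ n) ≡ false
≡ᵇ-false {m} {n} m≢n with m ≡ᵇ n in eq
... | true = ⊥-elim (m≢n (ℕₚ.≡ᵇ⇒≡ m n (subst T (sym eq) tt)))
... | false = refl

<ᵇ-+ˡ : ∀ c a b → (c ℕ.+ a <ᵇ c ℕ.+ b) ≡ (a <ᵇ b)
<ᵇ-+ˡ zero a b = refl
<ᵇ-+ˡ (suc c) a b = <ᵇ-+ˡ c a b

≤ᵇ⇒<ᵇsuc : ∀ m n → (m ≤ᵇ n) ≡ (m <ᵇ suc n)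
≤ᵇ⇒<ᵇsuc zero n = refl
≤ᵇ⇒<ᵇsuc (suc m) n = refl

<ᵇ-flip : ∀ m n → m ≢ n → (m <ᵇ n) ≡ not (n <ᵇ m)
<ᵇ-flip zero zero m≢n = ⊥-elim (m≢n refl)
<ᵇ-flip zero (suc n) m≢n = refl
<ᵇ-flip (suc m) zero m≢n = refl
<ᵇ-flip (suc m) (suc n) m≢n = <ᵇ-flip m n (m≢n ∘ cong suc)

<ᵇ-reflects : ∀ {a b c d} → (a < b → c < d) → (c < d → a < b) → (a <ᵇ b) ≡ (c <ᵇ d)
<ᵇ-reflects {a} {b} {c} {d} to from with a <ᵇ b in eq
... | true = sym (<ᵇ-true (to (<ᵇ-true⇒< eq)))
... | false = sym (<ᵇ-false (ℕₚ.≮⇒≥ (λ c<d → subst T eq (ℕₚ.<⇒<ᵇ (from c<d)))))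

ind : Bool → ℤ
ind true = + 1
ind false = + 0

openArc : ℕ → ℕ → ℕ → Bool
openArc A B x = if A <ᵇ B then (A <ᵇ x) ∧ (x <ᵇ B) else (A <ᵇ x) ∨ (x <ᵇ B)

halfOpenArc : ℕ → ℕ → ℕ → Bool
halfOpenArc A B x = if A <ᵇ B then (A <ᵇ x) ∧ (x <ᵇ suc B) else (A <ᵇ x) ∨ (x <ᵇ suc B)

inHalfOpen≡halfOpenArc : ∀ {k l} (a b g : Pt k l) → inHalfOpen a b g ≡ halfOpenArc (pos a) (pos b) (pos g)
inHalfOpen≡halfOpenArc a b g rewrite ≤ᵇ⇒<ᵇsuc (pos g) (pos b) = refl

OpenArcIndicator : ℕ → ℕ → ℕ → Set
OpenArcIndicator A B x =
  ind (openArc A B x) ≡ ind (x <ᵇ B) - ind (x <ᵇ A) - ind (x ≡ᵇ A) + ind (not (A <ᵇ B))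

HalfOpenArcIndicator : ℕ → ℕ → ℕ → Set
HalfOpenArcIndicator A B x =
  ind (halfOpenArc A B x) ≡ ind (x <ᵇ B) - ind (x <ᵇ A) + ind (x ≡ᵇ B) - ind (x ≡ᵇ A) + ind (not (A <ᵇ B))

private
  openArc-indicator-B0 : ∀ A x → OpenArcIndicator (suc A) zero (suc x)
  openArc-indicator-B0 zero zero = refl
  openArc-indicator-B0 (suc A) zero = refl
  openArc-indicator-B0 zero (suc x) = refl
  openArc-indicator-B0 (suc A) (suc x) = openArc-indicator-B0 A x

  halfOpenArc-indicator-A0 : ∀ B x → HalfOpenArcIndicator zero (suc B) (suc x)
  halfOpenArc-indicator-A0 zero zero = refl
  halfOpenArc-indicator-A0 (suc B) zero = refl
  halfOpenArc-indicator-A0 zero (suc x) = refl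
  halfOpenArc-indicator-A0 (suc B) (suc x) = halfOpenArc-indicator-A0 B x

  halfOpenArc-indicator-B0 : ∀ A x → HalfOpenArcIndicator (suc A) zero (suc x)
  halfOpenArc-indicator-B0 zero zero = refl
  halfOpenArc-indicator-B0 (suc A) zero = refl
  halfOpenArc-indicator-B0 zero (suc x) = refl
  halfOpenArc-indicator-B0 (suc A) (suc x) = halfOpenArc-indicator-B0 A x

openArc-indicator : ∀ A B x → A ≢ B → OpenArcIndicator A B x
openArc-indicator zero zero x A≢B = ⊥-elim (A≢B refl)
openArc-indicator zero (suc B) zero A≢B = refl
openArc-indicator zero (suc B) (suc x) A≢B with x <ᵇ B
... | true = refl
... | false = refl
openArc-indicator (suc A) zero zero A≢B = refl
openArc-indicator (suc A) zero (suc x) A≢B = openArc-indicator-B0 A x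
openArc-indicator (suc A) (suc B) zero A≢B with A <ᵇ B
... | true = refl
... | false = refl
openArc-indicator (suc A) (suc B) (suc x) A≢B = openArc-indicator A B x (A≢B ∘ cong suc)

halfOpenArc-indicator : ∀ A B x → A ≢ B → HalfOpenArcIndicator A B x
halfOpenArc-indicator zero zero x A≢B = ⊥-elim (A≢B refl)
halfOpenArc-indicator zero (suc B) zero A≢B = refl
halfOpenArc-indicator zero (suc B) (suc x) A≢B = halfOpenArc-indicator-A0 B x
halfOpenArc-indicator (suc A) zero zero A≢B = refl
halfOpenArc-indicator (suc A) zero (suc x) A≢B = halfOpenArc-indicator-B0 A x
halfOpenArc-indicator (suc A) (suc B) zero A≢B with A <ᵇ B
... | true = refl
... | false = refl
halfOpenArc-indicator (suc A) (suc B) (suc x) A≢B = halfOpenArc-indicator A B x (A≢B ∘ cong suc)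

sumℤ-++ : ∀ xs ys → sumℤ (xs ++ ys) ≡ sumℤ xs + sumℤ ys
sumℤ-++ [] ys = sym (ℤₚ.+-identityˡ _)
sumℤ-++ (x ∷ xs) ys = trans (cong (_+_ x) (sumℤ-++ xs ys)) (sym (ℤₚ.+-assoc x _ _))

module _ {A : Set} where

  sumℤ-map-cong : ∀ {f g : A → ℤ} xs → (∀ x → f x ≡ g x) → sumℤ (map f xs) ≡ sumℤ (map g xs)
  sumℤ-map-cong [] f≗g = refl
  sumℤ-map-cong (x ∷ xs) f≗g = cong₂ _+_ (f≗g x) (sumℤ-map-cong xs f≗g)

  sumℤ-map-+ : ∀ (f g : A → ℤ) xs → sumℤ (map (λ x → f x + g x) xs) ≡ sumℤ (map f xs) + sumℤ (map g xs)
  sumℤ-map-+ f g [] = refl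
  sumℤ-map-+ f g (x ∷ xs) = trans (cong (_+_ (f x + g x)) (sumℤ-map-+ f g xs)) (ℤ+.interchange (f x) (g x) _ _)

  sumℤ-map-neg : ∀ (f : A → ℤ) xs → sumℤ (map (λ x → - f x) xs) ≡ - sumℤ (map f xs)
  sumℤ-map-neg f [] = refl
  sumℤ-map-neg f (x ∷ xs) = trans (cong (_+_ (- f x)) (sumℤ-map-neg f xs)) (sym (ℤₚ.neg-distrib-+ (f x) _))

  sumℤ-map-minus : ∀ (f g : A → ℤ) xs → sumℤ (map (λ x → f x - g x) xs) ≡ sumℤ (map f xs) - sumℤ (map g xs)
  sumℤ-map-minus f g xs = trans (sumℤ-map-+ f (-_ ∘ g) xs) (cong (_+_ (sumℤ (map f xs))) (sumℤ-map-neg g xs))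

  sumℤ-map-*ˡ : ∀ c (f : A → ℤ) xs → sumℤ (map (λ x → c * f x) xs) ≡ c * sumℤ (map f xs)
  sumℤ-map-*ˡ c f [] = sym (ℤₚ.*-zeroʳ c)
  sumℤ-map-*ˡ c f (x ∷ xs) = trans (cong (_+_ (c * f x)) (sumℤ-map-*ˡ c f xs)) (sym (ℤₚ.*-distribˡ-+ c (f x) _))

  sumℤ-map-zero : ∀ {f : A → ℤ} xs → (∀ x → f x ≡ + 0) → sumℤ (map f xs) ≡ + 0
  sumℤ-map-zero [] f≗0 = refl
  sumℤ-map-zero (x ∷ xs) f≗0 = cong₂ _+_ (f≗0 x) (sumℤ-map-zero xs f≗0)

  sumℤ-filter : ∀ (S : A → Bool) (w : A → ℤ) xs →
    sumℤ (map w (filter (λ g → Data.Bool._≟_ (S g) true) xs)) ≡ sumℤ (map (λ g → ind (S g) * w g) xs)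
  sumℤ-filter S w [] = refl
  sumℤ-filter S w (x ∷ xs) with S x
  ... | true = cong₂ _+_ (sym (ℤₚ.*-identityˡ (w x))) (sumℤ-filter S w xs)
  ... | false = trans (sumℤ-filter S w xs) (sym (ℤₚ.+-identityˡ _))

sumFin : (n : ℕ) → (Fin n → ℤ) → ℤ
sumFin n f = sumℤ (map f (allFin n))

sumFin-cong : ∀ n {f g : Fin n → ℤ} → (∀ i → f i ≡ g i) → sumFin n f ≡ sumFin n g
sumFin-cong n = sumℤ-map-cong (allFin n)

sumFin-suc : ∀ n (f : Fin (suc n) → ℤ) → sumFin (suc n) f ≡ f Fin.zero + sumFin n (f ∘ Fin.suc)
sumFin-suc n f = cong (_+_ (f Fin.zero)) (cong sumℤ
  (trans (Listₚ.map-tabulate Fin.suc f) (sym (Listₚ.map-tabulate (λ i → i) (f ∘ Fin.suc)))))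

sumFin-+ : ∀ a b (f : Fin (a ℕ.+ b) → ℤ) → sumFin (a ℕ.+ b) f ≡ sumFin a (f ∘ (_↑ˡ b)) + sumFin b (f ∘ (a ↑ʳ_))
sumFin-+ zero b f = sym (ℤₚ.+-identityˡ _)
sumFin-+ (suc a) b f = begin
  sumFin (suc a ℕ.+ b) f                                 ≡⟨ sumFin-suc (a ℕ.+ b) f ⟩
  f Fin.zero + sumFin (a ℕ.+ b) (f ∘ Fin.suc)            ≡⟨ cong (_+_ (f Fin.zero)) (sumFin-+ a b (f ∘ Fin.suc)) ⟩
  f Fin.zero + (sumFin a (f ∘ Fin.suc ∘ (_↑ˡ b)) + rest) ≡⟨ sym (ℤₚ.+-assoc (f Fin.zero) _ rest) ⟩
  f Fin.zero + sumFin a (f ∘ Fin.suc ∘ (_↑ˡ b)) + rest   ≡⟨ cong (_+ rest) (sym (sumFin-suc a (f ∘ (_↑ˡ b)))) ⟩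
  sumFin (suc a) (f ∘ (_↑ˡ b)) + rest                    ∎
  where
  rest : ℤ
  rest = sumFin b (f ∘ (suc a ↑ʳ_))

sumFin-ind-true : ∀ n {c : Fin n → Bool} (f : Fin n → ℤ) → (∀ i → c i ≡ true) →
  sumFin n (λ i → ind (c i) * f i) ≡ sumFin n f
sumFin-ind-true n f c≗t = sumFin-cong n (λ i → trans (cong (λ b → ind b * f i) (c≗t i)) (ℤₚ.*-identityˡ (f i)))

sumFin-ind-false : ∀ n {c : Fin n → Bool} (f : Fin n → ℤ) → (∀ i → c i ≡ false) →
  sumFin n (λ i → ind (c i) * f i) ≡ + 0
sumFin-ind-false n f c≗f = sumℤ-map-zero (allFin n) (λ i → trans (cong (λ b → ind b * f i) (c≗f i)) (ℤₚ.*-zeroˡ (f i)))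

sumFin-delta : ∀ n (e : Fin n → ℕ) → (∀ {i j} → e i ≡ e j → i ≡ j) → (f : Fin n → ℤ) (i : Fin n) →
  sumFin n (λ j → ind (e j ≡ᵇ e i) * f j) ≡ f i
sumFin-delta (suc n) e e-inj f Fin.zero = begin
  sumFin (suc n) (λ j → ind (e j ≡ᵇ e Fin.zero) * f j)
    ≡⟨ sumFin-suc n (λ j → ind (e j ≡ᵇ e Fin.zero) * f j) ⟩
  ind (e Fin.zero ≡ᵇ e Fin.zero) * f Fin.zero + sumFin n (λ j → ind (e (Fin.suc j) ≡ᵇ e Fin.zero) * f (Fin.suc j))
    ≡⟨ cong₂ _+_ (cong (λ b → ind b * f Fin.zero) (≡ᵇ-refl (e Fin.zero)))
                 (sumFin-ind-false n (f ∘ Fin.suc) (λ j → ≡ᵇ-false (λ eq → Finₚ.0≢1+n (sym (e-inj eq))))) ⟩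
  + 1 * f Fin.zero + + 0
    ≡⟨ trans (ℤₚ.+-identityʳ _) (ℤₚ.*-identityˡ _) ⟩
  f Fin.zero ∎
sumFin-delta (suc n) e e-inj f (Fin.suc i) = begin
  sumFin (suc n) (λ j → ind (e j ≡ᵇ e (Fin.suc i)) * f j)
    ≡⟨ sumFin-suc n (λ j → ind (e j ≡ᵇ e (Fin.suc i)) * f j) ⟩
  ind (e Fin.zero ≡ᵇ e (Fin.suc i)) * f Fin.zero + sumFin n (λ j → ind (e (Fin.suc j) ≡ᵇ e (Fin.suc i)) * f (Fin.suc j))
    ≡⟨ cong₂ _+_ (cong (λ b → ind b * f Fin.zero) (≡ᵇ-false (λ eq → Finₚ.0≢1+n (e-inj eq))))
                 (sumFin-delta n (e ∘ Fin.suc) (Finₚ.suc-injective ∘ e-inj) (f ∘ Fin.suc) i) ⟩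
  + 0 * f Fin.zero + f (Fin.suc i)
    ≡⟨ ℤₚ.+-identityˡ _ ⟩
  f (Fin.suc i) ∎

pos-upper : ∀ {k l} (j : Fin l) → k ≤ pos {k} {l} (inj₂ j)
pos-upper {k} j = ℕₚ.m≤m+n k _

pos<k+l : ∀ {k l} (x : Pt k l) → pos x < k ℕ.+ l
pos<k+l {k} {l} (inj₁ i) = ℕₚ.<-≤-trans (Finₚ.toℕ<n i) (ℕₚ.m≤m+n k l)
pos<k+l {k} {l} (inj₂ j) = ℕₚ.+-monoʳ-< k (Finₚ.toℕ<n (opposite j))

lower<upper : ∀ {k l} (i : Fin k) (j : Fin l) → pos {k} {l} (inj₁ i) < pos {k} {l} (inj₂ j)
lower<upper i j = ℕₚ.<-≤-trans (Finₚ.toℕ<n i) (pos-upper j)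

opposite-injective : ∀ {n} {i j : Fin n} → toℕ (opposite i) ≡ toℕ (opposite j) → i ≡ j
opposite-injective {i = i} {j} eq =
  trans (sym (Finₚ.opposite-involutive i)) (trans (cong opposite (Finₚ.toℕ-injective eq)) (Finₚ.opposite-involutive j))

pos-injective : ∀ {k l} {a b : Pt k l} → pos a ≡ pos b → a ≡ b
pos-injective {a = inj₁ i} {inj₁ j} eq = cong inj₁ (Finₚ.toℕ-injective eq)
pos-injective {a = inj₁ i} {inj₂ j} eq = ⊥-elim (ℕₚ.<-irrefl eq (lower<upper i j))
pos-injective {a = inj₂ i} {inj₁ j} eq = ⊥-elim (ℕₚ.<-irrefl (sym eq) (lower<upper j i))
pos-injective {k} {a = inj₂ i} {inj₂ j} eq = cong inj₂ (opposite-injective (ℕₚ.+-cancelˡ-≡ k _ _ eq))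

sumPts : ∀ k l → (Pt k l → ℤ) → ℤ
sumPts k l f = sumℤ (map f (allPts k l))

sumPts-cong : ∀ {k l} {f g : Pt k l → ℤ} → (∀ x → f x ≡ g x) → sumPts k l f ≡ sumPts k l g
sumPts-cong {k} {l} = sumℤ-map-cong (allPts k l)

sumPts-split : ∀ k l (f : Pt k l → ℤ) → sumPts k l f ≡ sumFin k (f ∘ inj₁) + sumFin l (f ∘ inj₂)
sumPts-split k l f = begin
  sumℤ (map f (map inj₁ (allFin k) ++ map inj₂ (allFin l)))
    ≡⟨ cong sumℤ (Listₚ.map-++ f (map inj₁ (allFin k)) _) ⟩
  sumℤ (map f (map inj₁ (allFin k)) ++ map f (map inj₂ (allFin l)))
    ≡⟨ sumℤ-++ (map f (map inj₁ (allFin k))) _ ⟩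
  sumℤ (map f (map inj₁ (allFin k))) + sumℤ (map f (map inj₂ (allFin l)))
    ≡⟨ cong₂ _+_ (cong sumℤ (sym (Listₚ.map-∘ (allFin k)))) (cong sumℤ (sym (Listₚ.map-∘ (allFin l)))) ⟩
  sumFin k (f ∘ inj₁) + sumFin l (f ∘ inj₂) ∎

sumPts-delta : ∀ k l (f : Pt k l → ℤ) (a : Pt k l) → sumPts k l (λ g → ind (pos g ≡ᵇ pos a) * f g) ≡ f a
sumPts-delta k l f (inj₁ i) = begin
  sumPts k l (λ g → ind (pos g ≡ᵇ toℕ i) * f g)
    ≡⟨ sumPts-split k l _ ⟩
  sumFin k (λ j → ind (toℕ j ≡ᵇ toℕ i) * f (inj₁ j)) + sumFin l (λ j → ind (pos {k} {l} (inj₂ j) ≡ᵇ toℕ i) * f (inj₂ j))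
    ≡⟨ cong₂ _+_ (sumFin-delta k toℕ Finₚ.toℕ-injective (f ∘ inj₁) i)
                 (sumFin-ind-false l (f ∘ inj₂) (λ j → ≡ᵇ-false (λ eq → case pos-injective {a = inj₂ j} {inj₁ i} eq of λ ()))) ⟩
  f (inj₁ i) + + 0
    ≡⟨ ℤₚ.+-identityʳ _ ⟩
  f (inj₁ i) ∎
sumPts-delta k l f (inj₂ i) = begin
  sumPts k l (λ g → ind (pos g ≡ᵇ pos {k} {l} (inj₂ i)) * f g)
    ≡⟨ sumPts-split k l _ ⟩
  sumFin k (λ j → ind (toℕ j ≡ᵇ pos {k} {l} (inj₂ i)) * f (inj₁ j)) + sumFin l (λ j → ind (pos {k} {l} (inj₂ j) ≡ᵇ pos {k} {l} (inj₂ i)) * f (inj₂ j))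
    ≡⟨ cong₂ _+_ (sumFin-ind-false k (f ∘ inj₁) (λ j → ≡ᵇ-false (λ eq → case pos-injective {a = inj₁ j} {inj₂ i} eq of λ ())))
                 (sumFin-delta l (pos {k} {l} ∘ inj₂) (λ {i} {j} eq → case pos-injective {a = inj₂ i} {inj₂ j} eq of λ { refl → refl }) (f ∘ inj₂) i) ⟩
  + 0 + f (inj₂ i)
    ≡⟨ ℤₚ.+-identityˡ _ ⟩
  f (inj₂ i) ∎

-- Heights

weight : Bool → ℤ
weight c = if c then + 1 else - (+ 1)

offset : Bool → ℤ
offset c = if c then + 0 else - (+ 1)

module _ {k l : ℕ} (p : Partition k l) where

  weightBelow : ℕ → Pt k l → ℤ
  weightBelow X g = ind (pos g <ᵇ X) * wt p g

  prefix : ℕ → ℤ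
  prefix X = sumPts k l (weightBelow X)

  height : Pt k l → ℤ
  height a = prefix (pos a) + offset (normCol p a)

  σ-as-sum : ∀ S → σ p S ≡ sumPts k l (λ g → ind (S g) * wt p g)
  σ-as-sum S = sumℤ-filter S (wt p) (allPts k l)

  Σ-as-sum : Σp p ≡ sumPts k l (wt p)
  Σ-as-sum = trans (σ-as-sum (λ _ → true)) (sumPts-cong (λ g → ℤₚ.*-identityˡ (wt p g)))

  private
    sumPts-+ : ∀ (f g : Pt k l → ℤ) → sumPts k l (λ x → f x + g x) ≡ sumPts k l f + sumPts k l g
    sumPts-+ f g = sumℤ-map-+ f g (allPts k l)

    sumPts-minus : ∀ (f g : Pt k l → ℤ) → sumPts k l (λ x → f x - g x) ≡ sumPts k l f - sumPts k l g
    sumPts-minus f g = sumℤ-map-minus f g (allPts k l)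

    weightAt : ℕ → Pt k l → ℤ
    weightAt X g = ind (pos g ≡ᵇ X) * wt p g

    scaled : ℤ → Pt k l → ℤ
    scaled c g = c * wt p g

    sum-scaled : ∀ c → sumPts k l (scaled c) ≡ c * Σp p
    sum-scaled c = trans (sumℤ-map-*ˡ c (wt p) (allPts k l)) (cong (_*_ c) (sym Σ-as-sum))

  module _ {a b : Pt k l} (a≢b : a ≢ b) where
    private
      A B : ℕ
      A = pos a
      B = pos b
      K : ℤ
      K = ind (not (A <ᵇ B))

      A≢B : A ≢ B
      A≢B = a≢b ∘ pos-injective

      arc-sum : ∀ (inArc : ℕ → Bool) (f : Pt k l → ℤ) →
        (∀ x → ind (inArc (pos x)) * wt p x ≡ f x + scaled K x) →
        sumPts k l (λ g → ind (inArc (pos g)) * wt p g) ≡ sumPts k l f + K * Σp p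
      arc-sum inArc f pointwise = trans (sumPts-cong pointwise) (trans (sumPts-+ f (scaled K)) (cong (_+_ (sumPts k l f)) (sum-scaled K)))

    σ-open : σ p (inOpen a b) ≡ prefix B - prefix A + (- wt p a) + K * Σp p
    σ-open = begin
      σ p (inOpen a b)
        ≡⟨ σ-as-sum (inOpen a b) ⟩
      sumPts k l (λ g → ind (openArc A B (pos g)) * wt p g)
        ≡⟨ arc-sum (openArc A B) (λ g → weightBelow B g - weightBelow A g - weightAt A g) pointwise ⟩
      sumPts k l (λ g → weightBelow B g - weightBelow A g - weightAt A g) + K * Σp p
        ≡⟨ cong (_+ K * Σp p) (trans (sumPts-minus _ (weightAt A)) (cong₂ _-_ (sumPts-minus (weightBelow B) (weightBelow A)) (sumPts-delta k l (wt p) a))) ⟩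
      prefix B - prefix A - wt p a + K * Σp p ∎
      where
      pointwise : ∀ x → ind (openArc A B (pos x)) * wt p x ≡ weightBelow B x - weightBelow A x - weightAt A x + scaled K x
      pointwise x = trans (cong (λ z → z * wt p x) (openArc-indicator A B (pos x) A≢B))
                          (distrib (ind (pos x <ᵇ B)) (ind (pos x <ᵇ A)) (ind (pos x ≡ᵇ A)) K (wt p x))
        where distrib : ∀ s t u v w → (s - t - u + v) * w ≡ s * w - t * w - u * w + v * w
              distrib = solve-∀

    σ-halfOpen : σ p (inHalfOpen a b) ≡ prefix B - prefix A + (wt p b - wt p a) + K * Σp p
    σ-halfOpen = begin
      σ p (inHalfOpen a b)
        ≡⟨ trans (σ-as-sum (inHalfOpen a b)) (sumPts-cong (λ g → cong (λ c → ind c * wt p g) (inHalfOpen≡halfOpenArc a b g))) ⟩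
      sumPts k l (λ g → ind (halfOpenArc A B (pos g)) * wt p g)
        ≡⟨ arc-sum (halfOpenArc A B) (λ g → weightBelow B g - weightBelow A g + weightAt B g - weightAt A g) pointwise ⟩
      sumPts k l (λ g → weightBelow B g - weightBelow A g + weightAt B g - weightAt A g) + K * Σp p
        ≡⟨ cong (_+ K * Σp p) (trans (sumPts-minus _ (weightAt A))
             (cong₂ _-_ (trans (sumPts-+ _ (weightAt B)) (cong₂ _+_ (sumPts-minus (weightBelow B) (weightBelow A)) (sumPts-delta k l (wt p) b)))
                        (sumPts-delta k l (wt p) a))) ⟩
      prefix B - prefix A + wt p b - wt p a + K * Σp p
        ≡⟨ cong (_+ K * Σp p) (ℤₚ.+-assoc (prefix B - prefix A) (wt p b) (- wt p a)) ⟩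
      prefix B - prefix A + (wt p b - wt p a) + K * Σp p ∎
      where
      pointwise : ∀ x → ind (halfOpenArc A B (pos x)) * wt p x ≡
                        weightBelow B x - weightBelow A x + weightAt B x - weightAt A x + scaled K x
      pointwise x = trans (cong (λ z → z * wt p x) (halfOpenArc-indicator A B (pos x) A≢B))
                          (distrib (ind (pos x <ᵇ B)) (ind (pos x <ᵇ A)) (ind (pos x ≡ᵇ B)) (ind (pos x ≡ᵇ A)) K (wt p x))
        where distrib : ∀ s t u u' v w → (s - t + u - u' + v) * w ≡ s * w - t * w + u * w - u' * w + v * w
              distrib = solve-∀

if-boolEq : ∀ {A : Set} c d {x y z : A} → (c ≡ d → x ≡ z) → (c ≢ d → y ≡ z) → (if boolEq c d then x else y) ≡ z
if-boolEq true true same diff = same refl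
if-boolEq true false same diff = diff (λ ())
if-boolEq false true same diff = diff (λ ())
if-boolEq false false same diff = same refl

weight-same-colour : ∀ {c d} → c ≡ d → weight d - weight c ≡ offset d - offset c
weight-same-colour {true} refl = refl
weight-same-colour {false} refl = refl

weight-other-colour : ∀ {c d} → c ≢ d → - weight c ≡ offset d - offset c
weight-other-colour {true} {true} c≢d = ⊥-elim (c≢d refl)
weight-other-colour {true} {false} c≢d = refl
weight-other-colour {false} {true} c≢d = refl
weight-other-colour {false} {false} c≢d = ⊥-elim (c≢d refl)

δ-height : ∀ {k l} (p : Partition k l) {a b : Pt k l} → a ≢ b →
  δ p a b ≡ height p b - height p a + ind (not (pos a <ᵇ pos b)) * Σp p
δ-height p {a} {b} a≢b with a ≟P b
... | yes a≡b = ⊥-elim (a≢b a≡b)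
... | no _ = if-boolEq (normCol p a) (normCol p b)
  (λ same → trans (σ-halfOpen p a≢b) (regroup (wt p b - wt p a) (weight-same-colour same)))
  (λ diff → trans (σ-open p a≢b) (regroup (- wt p a) (weight-other-colour diff)))
  where
  regroup : ∀ x → x ≡ offset (normCol p b) - offset (normCol p a) →
    prefix p (pos b) - prefix p (pos a) + x + ind (not (pos a <ᵇ pos b)) * Σp p ≡
    height p b - height p a + ind (not (pos a <ᵇ pos b)) * Σp p
  regroup x refl = lemma (prefix p (pos b)) (prefix p (pos a)) (offset (normCol p b)) (offset (normCol p a)) _
    where lemma : ∀ PB PA ob oa X → PB - PA + (ob - oa) + X ≡ (PB + ob) - (PA + oa) + X
          lemma = solve-∀

-- Arcs and crossings

booleanRing : AlmostCommutativeRing _ _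
booleanRing = fromCommutativeRing Boolₚ.xor-∧-commutativeRing isFalse
  where
  isFalse : ∀ b → Maybe (false ≡ b)
  isFalse false = just refl
  isFalse true = nothing

-- agrees with openArc on pairwise distinct arguments (openArc≡arc); in this form
-- parities of arc memberships can be computed with the Boolean ring solver
arc : ℕ → ℕ → ℕ → Bool
arc A B x = ((A <ᵇ x) xor (x <ᵇ B)) xor (A <ᵇ B)

private
  openArc≡arc-A0 : ∀ B x → x ≢ B → openArc zero (suc B) (suc x) ≡ arc zero (suc B) (suc x)
  openArc≡arc-A0 zero zero x≢B = ⊥-elim (x≢B refl)
  openArc≡arc-A0 (suc B) zero x≢B = refl
  openArc≡arc-A0 zero (suc x) x≢B = refl
  openArc≡arc-A0 (suc B) (suc x) x≢B = openArc≡arc-A0 B x (x≢B ∘ cong suc)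

  openArc≡arc-B0 : ∀ A x → x ≢ A → openArc (suc A) zero (suc x) ≡ arc (suc A) zero (suc x)
  openArc≡arc-B0 zero zero x≢A = ⊥-elim (x≢A refl)
  openArc≡arc-B0 (suc A) zero x≢A = refl
  openArc≡arc-B0 zero (suc x) x≢A = refl
  openArc≡arc-B0 (suc A) (suc x) x≢A = openArc≡arc-B0 A x (x≢A ∘ cong suc)

openArc≡arc : ∀ A B x → A ≢ B → x ≢ A → x ≢ B → openArc A B x ≡ arc A B x
openArc≡arc zero zero x A≢B _ _ = ⊥-elim (A≢B refl)
openArc≡arc zero (suc B) zero _ x≢A _ = ⊥-elim (x≢A refl)
openArc≡arc zero (suc B) (suc x) _ _ x≢B = openArc≡arc-A0 B x (x≢B ∘ cong suc)
openArc≡arc (suc A) zero zero _ _ x≢B = ⊥-elim (x≢B refl)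
openArc≡arc (suc A) zero (suc x) _ x≢A _ = openArc≡arc-B0 A x (x≢A ∘ cong suc)
openArc≡arc (suc A) (suc B) zero _ _ _ with A <ᵇ B
... | true = refl
... | false = refl
openArc≡arc (suc A) (suc B) (suc x) A≢B x≢A x≢B =
  openArc≡arc A B x (A≢B ∘ cong suc) (x≢A ∘ cong suc) (x≢B ∘ cong suc)

arc-flip : ∀ A B x → A ≢ B → x ≢ A → x ≢ B → arc B A x ≡ not (arc A B x)
arc-flip A B x A≢B x≢A x≢B
  rewrite <ᵇ-flip B x (x≢B ∘ sym) | <ᵇ-flip x A x≢A | <ᵇ-flip B A (A≢B ∘ sym) =
  lemma (x <ᵇ B) (A <ᵇ x) (A <ᵇ B)
  where
  lemma : ∀ s t u → (not s xor not t) xor not u ≡ not ((t xor s) xor u)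
  lemma s t u rewrite sym (Boolₚ.true-xor s) | sym (Boolₚ.true-xor t) | sym (Boolₚ.true-xor u)
                    | sym (Boolₚ.true-xor ((t xor s) xor u)) = identity s t u
    where identity : ∀ s t u → ((true xor s) xor (true xor t)) xor (true xor u) ≡ true xor ((t xor s) xor u)
          identity = BoolSolver.solve-∀ booleanRing

-- crossing of chords is symmetric
arc-symmetric : ∀ u v x y → u ≢ x → v ≢ y → arc u v x xor arc u v y ≡ arc x y u xor arc x y v
arc-symmetric u v x y u≢x v≢y rewrite <ᵇ-flip x u (u≢x ∘ sym) | <ᵇ-flip v y v≢y =
  lemma (u <ᵇ x) (x <ᵇ v) (u <ᵇ v) (u <ᵇ y) (y <ᵇ v) (x <ᵇ y)
  where
  lemma : ∀ s₁ s₂ s₃ s₄ s₅ t → ((s₁ xor s₂) xor s₃) xor ((s₄ xor s₅) xor s₃) ≡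
                                ((not s₁ xor s₄) xor t) xor ((s₂ xor not s₅) xor t)
  lemma s₁ s₂ s₃ s₄ s₅ t rewrite sym (Boolₚ.true-xor s₁) | sym (Boolₚ.true-xor s₅) = identity s₁ s₂ s₃ s₄ s₅ t
    where identity : ∀ s₁ s₂ s₃ s₄ s₅ t → ((s₁ xor s₂) xor s₃) xor ((s₄ xor s₅) xor s₃) ≡
                                           (((true xor s₁) xor s₄) xor t) xor ((s₂ xor (true xor s₅)) xor t)
          identity = BoolSolver.solve-∀ booleanRing

arc-cong : ∀ A B x y → (A <ᵇ x) xor (x <ᵇ B) ≡ (A <ᵇ y) xor (y <ᵇ B) → arc A B x ≡ arc A B y
arc-cong A B x y eq = cong (_xor (A <ᵇ B)) eq

arc-same-side : ∀ A B x y → (A <ᵇ x) ≡ (A <ᵇ y) → (x <ᵇ B) ≡ (y <ᵇ B) → arc A B x ≡ arc A B y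
arc-same-side A B x y eq₁ eq₂ = arc-cong A B x y (cong₂ _xor_ eq₁ eq₂)

arc-degenerate : ∀ A x → x ≢ A → arc A A x ≡ true
arc-degenerate A x x≢A rewrite <ᵇ-flip x A x≢A | <ᵇ-false {A} {A} ℕₚ.≤-refl with A <ᵇ x
... | true = refl
... | false = refl

arc-+ˡ : ∀ c A B x → arc (c ℕ.+ A) (c ℕ.+ B) (c ℕ.+ x) ≡ arc A B x
arc-+ˡ c A B x rewrite <ᵇ-+ˡ c A B | <ᵇ-+ˡ c A x | <ᵇ-+ˡ c x B = refl

arc-outside : ∀ {A B x} → (x < A × x < B) ⊎ (A < x × B < x) → (A <ᵇ x) xor (x <ᵇ B) ≡ true
arc-outside {A} {B} {x} (inj₁ (x<A , x<B)) rewrite <ᵇ-false {A} {x} (ℕₚ.<⇒≤ x<A) | <ᵇ-true x<B = refl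
arc-outside {A} {B} {x} (inj₂ (A<x , B<x)) rewrite <ᵇ-true A<x | <ᵇ-false {x} {B} (ℕₚ.<⇒≤ B<x) = refl

module _ {k l : ℕ} (p : Partition k l) where
  private
    module ~ = IsEquivalence (isEquiv p)
    _≈_ = _~_ p

    pos-≢ : ∀ {x y : Pt k l} → x ≢ y → pos x ≢ pos y
    pos-≢ x≢y = x≢y ∘ pos-injective

  cross⇒arcs : ∀ {c₁ c₂} → Cross p c₁ c₂ → ∃[ b₁ ] ∃[ b₂ ] (c₁ ≈ b₁ × c₂ ≈ b₂ ×
    arc (pos c₁) (pos b₁) (pos c₂) ≡ true × arc (pos c₁) (pos b₁) (pos b₂) ≡ false)
  cross⇒arcs {c₁} {c₂} (c₁≁c₂ , b₁ , b₂ , c₁~b₁ , c₂~b₂ , c₁≢b₁ , c₂≢b₂ , c₂∈ , b₂∈) =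
    b₁ , b₂ , c₁~b₁ , c₂~b₂ , c₂-inside , b₂-outside
    where
    c₂≢c₁ : c₂ ≢ c₁
    c₂≢c₁ refl = c₁≁c₂ ~.refl
    c₂≢b₁ : c₂ ≢ b₁
    c₂≢b₁ refl = c₁≁c₂ c₁~b₁
    b₂≢c₁ : b₂ ≢ c₁
    b₂≢c₁ refl = c₁≁c₂ (~.sym c₂~b₂)
    b₂≢b₁ : b₂ ≢ b₁
    b₂≢b₁ refl = c₁≁c₂ (~.trans c₁~b₁ (~.sym c₂~b₂))
    c₂-inside : arc (pos c₁) (pos b₁) (pos c₂) ≡ true
    c₂-inside = trans (sym (openArc≡arc _ _ _ (pos-≢ c₁≢b₁) (pos-≢ c₂≢c₁) (pos-≢ c₂≢b₁))) c₂∈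
    b₂-outside : arc (pos c₁) (pos b₁) (pos b₂) ≡ false
    b₂-outside = trans (arc-flip (pos b₁) (pos c₁) (pos b₂) (pos-≢ (c₁≢b₁ ∘ sym)) (pos-≢ b₂≢b₁) (pos-≢ b₂≢c₁))
      (cong not (trans (sym (openArc≡arc _ _ _ (pos-≢ (c₁≢b₁ ∘ sym)) (pos-≢ b₂≢b₁) (pos-≢ b₂≢c₁))) b₂∈))

  separated⇒cross : ∀ {x' y' u v} → x' ≈ y' → u ≈ v → ¬ x' ≈ u → x' ≢ y' → u ≢ v →
    arc (pos x') (pos y') (pos u) ≡ true → arc (pos x') (pos y') (pos v) ≡ false → Cross p x' u
  separated⇒cross {x'} {y'} {u} {v} x'~y' u~v x'≁u x'≢y' u≢v u-in v-out =
    x'≁u , y' , v , x'~y' , u~v , x'≢y' , u≢v ,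
    trans (openArc≡arc _ _ _ (pos-≢ x'≢y') (pos-≢ u≢x') (pos-≢ u≢y')) u-in ,
    trans (openArc≡arc _ _ _ (pos-≢ (x'≢y' ∘ sym)) (pos-≢ v≢y') (pos-≢ v≢x'))
          (trans (arc-flip _ _ _ (pos-≢ x'≢y') (pos-≢ v≢x') (pos-≢ v≢y')) (cong not v-out))
    where
    u≢x' : u ≢ x'
    u≢x' refl = x'≁u ~.refl
    u≢y' : u ≢ y'
    u≢y' refl = x'≁u x'~y'
    v≢x' : v ≢ x'
    v≢x' refl = x'≁u (~.sym u~v)
    v≢y' : v ≢ y'
    v≢y' refl = x'≁u (~.trans x'~y' (~.sym u~v))

  arcs⇒cross : ∀ {x' y' x y} → x' ≈ y' → x ≈ y → ¬ x' ≈ x →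
    arc (pos x') (pos y') (pos x) xor arc (pos x') (pos y') (pos y) ≡ true → ∃[ z ] (x ≈ z × Cross p x' z)
  arcs⇒cross {x'} {y'} {x} {y} x'~y' x~y x'≁x odd with x' ≟P y' | x ≟P y
  ... | yes refl | _ = case trans (sym (cong₂ _xor_ x-inside y-inside)) odd of λ ()
    where
    x-inside : arc (pos x') (pos x') (pos x) ≡ true
    x-inside = arc-degenerate (pos x') (pos x) (pos-≢ {x} {x'} λ { refl → x'≁x ~.refl })
    y-inside : arc (pos x') (pos x') (pos y) ≡ true
    y-inside = arc-degenerate (pos x') (pos y) (pos-≢ {y} {x'} λ { refl → x'≁x (~.sym x~y) })
  ... | no _ | yes refl = case trans (sym (Boolₚ.xor-same (arc (pos x') (pos y') (pos x)))) odd of λ ()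
  ... | no x'≢y' | no x≢y with arc (pos x') (pos y') (pos x) in x-side | arc (pos x') (pos y') (pos y) in y-side
  ... | true | false = x , ~.refl , separated⇒cross x'~y' x~y x'≁x x'≢y' x≢y x-side y-side
  ... | false | true = y , x~y , separated⇒cross x'~y' (~.sym x~y) (x'≁x ∘ λ x'~y → ~.trans x'~y (~.sym x~y))
                                   x'≢y' (x≢y ∘ sym) y-side x-side
  ... | true | true = case odd of λ ()
  ... | false | false = case odd of λ ()

-- Involution

<ᵇ-complement : ∀ {a a' b b' N} → a ℕ.+ suc a' ≡ N → b ℕ.+ suc b' ≡ N → (a' <ᵇ b') ≡ (b <ᵇ a)
<ᵇ-complement {a} {a'} {b} {b'} eqa eqb = <ᵇ-reflects to from
  where
  to : a' < b' → b < a
  to a'<b' = ℕₚ.+-cancelʳ-< (suc b') b a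
    (subst (_< a ℕ.+ suc b') (trans eqa (sym eqb)) (ℕₚ.+-monoʳ-< a (s≤s a'<b')))
  from : b < a → a' < b'
  from b<a = ℕₚ.≤-pred (ℕₚ.+-cancelˡ-< a (suc a') (suc b')
    (subst (_< a ℕ.+ suc b') (trans eqb (sym eqa)) (ℕₚ.+-monoˡ-< (suc b') b<a)))

opposite+suc : ∀ {n} (i : Fin n) → toℕ (opposite i) ℕ.+ suc (toℕ i) ≡ n
opposite+suc i = trans (cong (ℕ._+ suc (toℕ i)) (Finₚ.opposite-prop i)) (ℕₚ.m∸n+n≡m (Finₚ.toℕ<n i))

<ᵇ-opposite : ∀ {n} (i j : Fin n) → (toℕ (opposite i) <ᵇ toℕ (opposite j)) ≡ (toℕ j <ᵇ toℕ i)
<ᵇ-opposite i j = sym (<ᵇ-complement (opposite+suc j) (opposite+suc i))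

ind-<ᵇ-flip : ∀ x y → ind (x <ᵇ y) ≡ + 1 - ind (y <ᵇ x) - ind (y ≡ᵇ x)
ind-<ᵇ-flip zero zero = refl
ind-<ᵇ-flip zero (suc y) = refl
ind-<ᵇ-flip (suc x) zero = refl
ind-<ᵇ-flip (suc x) (suc y) = ind-<ᵇ-flip x y

weight-not : ∀ c → weight (not c) ≡ - weight c
weight-not true = refl
weight-not false = refl

weight+offset-not : ∀ c → weight c + offset (not c) ≡ offset c
weight+offset-not true = refl
weight+offset-not false = refl

module _ {k l : ℕ} (p : Partition k l) where

  pos-swap : ∀ (x : Pt l k) → pos {k} {l} (swapPt x) ℕ.+ suc (pos x) ≡ k ℕ.+ l
  pos-swap (inj₁ j) = begin
    k ℕ.+ toℕ (opposite j) ℕ.+ suc (toℕ j)   ≡⟨ ℕₚ.+-assoc k _ _ ⟩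
    k ℕ.+ (toℕ (opposite j) ℕ.+ suc (toℕ j)) ≡⟨ cong (k ℕ.+_) (opposite+suc j) ⟩
    k ℕ.+ l                                   ∎
  pos-swap (inj₂ i) = begin
    toℕ i ℕ.+ suc (l ℕ.+ toℕ (opposite i))   ≡⟨ lemma (toℕ i) l (toℕ (opposite i)) ⟩
    l ℕ.+ (toℕ (opposite i) ℕ.+ suc (toℕ i)) ≡⟨ cong (l ℕ.+_) (opposite+suc i) ⟩
    l ℕ.+ k                                   ≡⟨ ℕₚ.+-comm l k ⟩
    k ℕ.+ l                                   ∎
    where
    lemma : ∀ t l o → t ℕ.+ suc (l ℕ.+ o) ≡ l ℕ.+ (o ℕ.+ suc t)
    lemma = ℕSolver.solve-∀

  <ᵇ-swap : ∀ (a b : Pt l k) → (pos a <ᵇ pos b) ≡ (pos {k} {l} (swapPt b) <ᵇ pos {k} {l} (swapPt a))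
  <ᵇ-swap a b = <ᵇ-complement (pos-swap a) (pos-swap b)

  normCol-* : ∀ x → normCol (p *) x ≡ not (normCol p (swapPt x))
  normCol-* (inj₁ j) = sym (Boolₚ.not-involutive (upperCol p j))
  normCol-* (inj₂ i) = refl

  wt-* : ∀ x → wt (p *) x ≡ - wt p (swapPt x)
  wt-* x = trans (cong weight (normCol-* x)) (weight-not (normCol p (swapPt x)))

  sumPts-swap : ∀ (f : Pt k l → ℤ) → sumPts l k (f ∘ swapPt) ≡ sumPts k l f
  sumPts-swap f = trans (sumPts-split l k (f ∘ swapPt))
    (trans (ℤₚ.+-comm (sumFin l (f ∘ inj₂)) (sumFin k (f ∘ inj₁))) (sym (sumPts-split k l f)))

  Σ-* : Σp (p *) ≡ - Σp p
  Σ-* = begin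
    Σp (p *)                         ≡⟨ Σ-as-sum (p *) ⟩
    sumPts l k (wt (p *))            ≡⟨ sumPts-cong wt-* ⟩
    sumPts l k (λ x → - wt p (swapPt x)) ≡⟨ sumPts-swap (λ y → - wt p y) ⟩
    sumPts k l (λ y → - wt p y)      ≡⟨ sumℤ-map-neg (wt p) (allPts k l) ⟩
    - sumPts k l (wt p)              ≡⟨ cong -_ (sym (Σ-as-sum p)) ⟩
    - Σp p                           ∎

  -- points before x in p * are the points after swapPt x in p, with negated weights
  height-* : ∀ x → height (p *) x ≡ height p (swapPt x) - Σp p
  height-* x = begin
    prefix (p *) (pos x) + offset (normCol (p *) x)
      ≡⟨ cong₂ _+_ (sumPts-cong (λ g → cong₂ _*_ (cong ind (<ᵇ-swap g x)) (wt-* g))) (cong offset (normCol-* x)) ⟩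
    sumPts l k (λ g → ind (X <ᵇ pos (swapPt g)) * (- wt p (swapPt g))) + offset (not c)
      ≡⟨ cong (_+ offset (not c)) (sumPts-swap (λ y → ind (X <ᵇ pos y) * (- wt p y))) ⟩
    sumPts k l (λ y → ind (X <ᵇ pos y) * (- wt p y)) + offset (not c)
      ≡⟨ cong (_+ offset (not c)) (sumPts-cong (λ y → flip (pos y) (wt p y))) ⟩
    sumPts k l (λ y → weightBelow p X y + weightAt y - wt p y) + offset (not c)
      ≡⟨ cong (_+ offset (not c)) (trans (sumℤ-map-minus _ (wt p) (allPts k l))
           (cong₂ _-_ (trans (sumℤ-map-+ (weightBelow p X) weightAt (allPts k l)) (cong (_+_ (prefix p X)) (sumPts-delta k l (wt p) (swapPt x))))
                      (sym (Σ-as-sum p)))) ⟩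
    prefix p X + weight c - Σp p + offset (not c)
      ≡⟨ lemma (prefix p X) (weight c) (Σp p) (offset (not c)) ⟩
    prefix p X + (weight c + offset (not c)) - Σp p
      ≡⟨ cong (λ o → prefix p X + o - Σp p) (weight+offset-not c) ⟩
    height p (swapPt x) - Σp p ∎
    where
    X : ℕ
    X = pos (swapPt x)
    c : Bool
    c = normCol p (swapPt x)
    weightAt : Pt k l → ℤ
    weightAt y = ind (pos y ≡ᵇ X) * wt p y
    flip : ∀ Y w → ind (X <ᵇ Y) * (- w) ≡ ind (Y <ᵇ X) * w + ind (Y ≡ᵇ X) * w - w
    flip Y w = trans (cong (λ i → i * (- w)) (ind-<ᵇ-flip X Y)) (distrib (ind (Y <ᵇ X)) (ind (Y ≡ᵇ X)) w)
      where distrib : ∀ s t w → (+ 1 - s - t) * (- w) ≡ s * w + t * w - w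
            distrib = solve-∀
    lemma : ∀ P w s o → P + w - s + o ≡ P + (w + o) - s
    lemma = solve-∀

  inOpen-* : ∀ x y z → inOpen {l} {k} x y z ≡ inOpen (swapPt y) (swapPt x) (swapPt z)
  inOpen-* x y z rewrite <ᵇ-swap x y | <ᵇ-swap x z | <ᵇ-swap z y with pos {k} {l} (swapPt y) <ᵇ pos (swapPt x)
  ... | true = Boolₚ.∧-comm (pos (swapPt z) <ᵇ pos (swapPt x)) (pos (swapPt y) <ᵇ pos (swapPt z))
  ... | false = Boolₚ.∨-comm (pos (swapPt z) <ᵇ pos (swapPt x)) (pos (swapPt y) <ᵇ pos (swapPt z))

  swapPt-injective : ∀ {a b : Pt l k} → swapPt {k} {l} a ≡ swapPt b → a ≡ b
  swapPt-injective {inj₁ _} {inj₁ _} refl = refl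
  swapPt-injective {inj₂ _} {inj₂ _} refl = refl

  cross-* : ∀ {c₁ c₂} → Cross (p *) c₁ c₂ → ∃[ c₂' ] (_~_ (p *) c₂ c₂' × Cross p (swapPt c₁) (swapPt c₂'))
  cross-* {c₁} {c₂} (c₁≁c₂ , b₁ , b₂ , c₁~b₁ , c₂~b₂ , c₁≢b₁ , c₂≢b₂ , c₂∈ , b₂∈) =
    b₂ , c₂~b₂ ,
    (λ c₁~b₂ → c₁≁c₂ (~.trans c₁~b₂ (~.sym c₂~b₂))) , swapPt b₁ , swapPt c₂ , c₁~b₁ , ~.sym c₂~b₂ ,
    c₁≢b₁ ∘ swapPt-injective , c₂≢b₂ ∘ sym ∘ swapPt-injective ,
    trans (sym (inOpen-* b₁ c₁ b₂)) b₂∈ , trans (sym (inOpen-* c₁ b₁ c₂)) c₂∈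
    where module ~ = IsEquivalence (isEquiv p)

-- Tensor product

isUpper : ∀ {k l} → Pt k l → Bool
isUpper (inj₁ _) = false
isUpper (inj₂ _) = true

module Tensor {k₁ l₁ k₂ l₂ : ℕ} (p : Partition k₁ l₁) (q : Partition k₂ l₂) where

  private
    K L : ℕ
    K = k₁ ℕ.+ k₂
    L = l₁ ℕ.+ l₂

  leftPt : Pt k₁ l₁ → Pt K L
  leftPt (inj₁ i) = inj₁ (i ↑ˡ k₂)
  leftPt (inj₂ j) = inj₂ (j ↑ˡ l₂)

  rightPt : Pt k₂ l₂ → Pt K L
  rightPt (inj₁ i) = inj₁ (k₁ ↑ʳ i)
  rightPt (inj₂ j) = inj₂ (l₁ ↑ʳ j)

  sideP-left : ∀ x → sideP {k₁} {l₁} {k₂} {l₂} (leftPt x) ≡ inj₁ x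
  sideP-left (inj₁ i) rewrite Finₚ.splitAt-↑ˡ k₁ i k₂ = refl
  sideP-left (inj₂ j) rewrite Finₚ.splitAt-↑ˡ l₁ j l₂ = refl

  sideP-right : ∀ y → sideP {k₁} {l₁} {k₂} {l₂} (rightPt y) ≡ inj₂ y
  sideP-right (inj₁ i) rewrite Finₚ.splitAt-↑ʳ k₁ k₂ i = refl
  sideP-right (inj₂ j) rewrite Finₚ.splitAt-↑ʳ l₁ l₂ j = refl

  left-or-right : ∀ g → (∃[ x ] leftPt x ≡ g) ⊎ (∃[ y ] rightPt y ≡ g)
  left-or-right (inj₁ i) with splitAt k₁ i in eq
  ... | inj₁ i₁ = inj₁ (inj₁ i₁ , cong inj₁ (Finₚ.splitAt⁻¹-↑ˡ eq))
  ... | inj₂ i₂ = inj₂ (inj₁ i₂ , cong inj₁ (Finₚ.splitAt⁻¹-↑ʳ eq))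
  left-or-right (inj₂ j) with splitAt l₁ j in eq
  ... | inj₁ j₁ = inj₁ (inj₂ j₁ , cong inj₂ (Finₚ.splitAt⁻¹-↑ˡ eq))
  ... | inj₂ j₂ = inj₂ (inj₂ j₂ , cong inj₂ (Finₚ.splitAt⁻¹-↑ʳ eq))

  normCol-left : ∀ x → normCol (p ⊗ q) (leftPt x) ≡ normCol p x
  normCol-left (inj₁ i) rewrite Finₚ.splitAt-↑ˡ k₁ i k₂ = refl
  normCol-left (inj₂ j) rewrite Finₚ.splitAt-↑ˡ l₁ j l₂ = refl

  normCol-right : ∀ y → normCol (p ⊗ q) (rightPt y) ≡ normCol q y
  normCol-right (inj₁ i) rewrite Finₚ.splitAt-↑ʳ k₁ k₂ i = refl
  normCol-right (inj₂ j) rewrite Finₚ.splitAt-↑ʳ l₁ l₂ j = refl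

  private
    _≈_ = SumRel (_~_ p) (_~_ q)

  ~-left⁻ : ∀ x y → _~_ (p ⊗ q) (leftPt x) (leftPt y) → _~_ p x y
  ~-left⁻ x y r with subst₂ _≈_ (sideP-left x) (sideP-left y) r
  ... | ₁∼₁ x~y = x~y

  ~-left : ∀ x y → _~_ p x y → _~_ (p ⊗ q) (leftPt x) (leftPt y)
  ~-left x y x~y = subst₂ _≈_ (sym (sideP-left x)) (sym (sideP-left y)) (₁∼₁ x~y)

  ~-right⁻ : ∀ x y → _~_ (p ⊗ q) (rightPt x) (rightPt y) → _~_ q x y
  ~-right⁻ x y r with subst₂ _≈_ (sideP-right x) (sideP-right y) r
  ... | ₂∼₂ x~y = x~y

  ~-right : ∀ x y → _~_ q x y → _~_ (p ⊗ q) (rightPt x) (rightPt y)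
  ~-right x y x~y = subst₂ _≈_ (sym (sideP-right x)) (sym (sideP-right y)) (₂∼₂ x~y)

  left≁right : ∀ x y → ¬ _~_ (p ⊗ q) (leftPt x) (rightPt y)
  left≁right x y r with subst₂ _≈_ (sideP-left x) (sideP-right y) r
  ... | ()

  same-side-left : ∀ {x g} → _~_ (p ⊗ q) (leftPt x) g → ∃[ y ] leftPt y ≡ g
  same-side-left {x} {g} r with left-or-right g
  ... | inj₁ s = s
  ... | inj₂ (y , refl) = ⊥-elim (left≁right x y r)

  same-side-right : ∀ {x g} → _~_ (p ⊗ q) (rightPt x) g → ∃[ y ] rightPt y ≡ g
  same-side-right {x} {g} r with left-or-right g
  ... | inj₁ (y , refl) = ⊥-elim (left≁right y x (IsEquivalence.sym (isEquiv (p ⊗ q)) {rightPt x} {leftPt y} r))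
  ... | inj₂ s = s

  sumPts-⊗ : ∀ (f : Pt K L → ℤ) → sumPts K L f ≡ sumPts k₁ l₁ (f ∘ leftPt) + sumPts k₂ l₂ (f ∘ rightPt)
  sumPts-⊗ f = begin
    sumPts K L f
      ≡⟨ sumPts-split K L f ⟩
    sumFin K (f ∘ inj₁) + sumFin L (f ∘ inj₂)
      ≡⟨ cong₂ _+_ (sumFin-+ k₁ k₂ (f ∘ inj₁)) (sumFin-+ l₁ l₂ (f ∘ inj₂)) ⟩
    (sumFin k₁ (f ∘ leftPt ∘ inj₁) + sumFin k₂ (f ∘ rightPt ∘ inj₁)) + (sumFin l₁ (f ∘ leftPt ∘ inj₂) + sumFin l₂ (f ∘ rightPt ∘ inj₂))
      ≡⟨ ℤ+.interchange (sumFin k₁ _) _ _ _ ⟩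
    (sumFin k₁ (f ∘ leftPt ∘ inj₁) + sumFin l₁ (f ∘ leftPt ∘ inj₂)) + (sumFin k₂ (f ∘ rightPt ∘ inj₁) + sumFin l₂ (f ∘ rightPt ∘ inj₂))
      ≡⟨ cong₂ _+_ (sym (sumPts-split k₁ l₁ (f ∘ leftPt))) (sym (sumPts-split k₂ l₂ (f ∘ rightPt))) ⟩
    sumPts k₁ l₁ (f ∘ leftPt) + sumPts k₂ l₂ (f ∘ rightPt) ∎

  pos-left-lower : ∀ i → pos {K} {L} (leftPt (inj₁ i)) ≡ toℕ i
  pos-left-lower i = Finₚ.toℕ-↑ˡ i k₂

  pos-left-upper : ∀ j → pos {K} {L} (leftPt (inj₂ j)) ≡ pos {k₁} {l₁} (inj₂ j) ℕ.+ (k₂ ℕ.+ l₂)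
  pos-left-upper j = begin
    K ℕ.+ toℕ (opposite (j ↑ˡ l₂))              ≡⟨ cong (K ℕ.+_) (Finₚ.opposite-prop (j ↑ˡ l₂)) ⟩
    K ℕ.+ (L ∸ suc (toℕ (j ↑ˡ l₂)))             ≡⟨ cong (λ t → K ℕ.+ (L ∸ suc t)) (Finₚ.toℕ-↑ˡ j l₂) ⟩
    K ℕ.+ (L ∸ suc (toℕ j))                     ≡⟨ cong (K ℕ.+_) (ℕₚ.+-∸-comm l₂ (Finₚ.toℕ<n j)) ⟩
    K ℕ.+ ((l₁ ∸ suc (toℕ j)) ℕ.+ l₂)           ≡⟨ cong (λ t → K ℕ.+ (t ℕ.+ l₂)) (sym (Finₚ.opposite-prop j)) ⟩
    (k₁ ℕ.+ k₂) ℕ.+ (toℕ (opposite j) ℕ.+ l₂)   ≡⟨ ℕ+.interchange k₁ k₂ _ l₂ ⟩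
    (k₁ ℕ.+ toℕ (opposite j)) ℕ.+ (k₂ ℕ.+ l₂)   ∎

  pos-right : ∀ y → pos {K} {L} (rightPt y) ≡ k₁ ℕ.+ pos {k₂} {l₂} y
  pos-right (inj₁ i) = Finₚ.toℕ-↑ʳ k₁ i
  pos-right (inj₂ j) = begin
    K ℕ.+ toℕ (opposite (l₁ ↑ʳ j))        ≡⟨ cong (K ℕ.+_) (Finₚ.opposite-prop (l₁ ↑ʳ j)) ⟩
    K ℕ.+ (L ∸ suc (toℕ (l₁ ↑ʳ j)))       ≡⟨ cong (λ t → K ℕ.+ (L ∸ suc t)) (Finₚ.toℕ-↑ʳ l₁ j) ⟩
    K ℕ.+ (L ∸ suc (l₁ ℕ.+ toℕ j))        ≡⟨ cong (λ t → K ℕ.+ (L ∸ t)) (sym (ℕₚ.+-suc l₁ (toℕ j))) ⟩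
    K ℕ.+ (L ∸ (l₁ ℕ.+ suc (toℕ j)))      ≡⟨ cong (K ℕ.+_) (ℕₚ.[m+n]∸[m+o]≡n∸o l₁ l₂ (suc (toℕ j))) ⟩
    K ℕ.+ (l₂ ∸ suc (toℕ j))              ≡⟨ cong (K ℕ.+_) (sym (Finₚ.opposite-prop j)) ⟩
    (k₁ ℕ.+ k₂) ℕ.+ toℕ (opposite j)      ≡⟨ ℕₚ.+-assoc k₁ k₂ _ ⟩
    k₁ ℕ.+ (k₂ ℕ.+ toℕ (opposite j))      ∎

  private
    lower<left-upper : ∀ i j → toℕ i < pos {k₁} {l₁} (inj₂ j) ℕ.+ (k₂ ℕ.+ l₂)
    lower<left-upper i j = ℕₚ.<-≤-trans (lower<upper {k₁} {l₁} i j) (ℕₚ.m≤m+n _ (k₂ ℕ.+ l₂))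

    right<left-upper : ∀ (y : Pt k₂ l₂) j → k₁ ℕ.+ pos y < pos {k₁} {l₁} (inj₂ j) ℕ.+ (k₂ ℕ.+ l₂)
    right<left-upper y j = ℕₚ.<-≤-trans (ℕₚ.+-monoʳ-< k₁ (pos<k+l y)) (ℕₚ.+-monoˡ-≤ (k₂ ℕ.+ l₂) (pos-upper {k₁} {l₁} j))

  <ᵇ-left-left : ∀ g x → (pos (leftPt g) <ᵇ pos (leftPt x)) ≡ (pos g <ᵇ pos x)
  <ᵇ-left-left (inj₁ i) (inj₁ i') rewrite pos-left-lower i | pos-left-lower i' = refl
  <ᵇ-left-left (inj₁ i) (inj₂ j) rewrite pos-left-lower i | pos-left-upper j =
    trans (<ᵇ-true (lower<left-upper i j)) (sym (<ᵇ-true (lower<upper i j)))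
  <ᵇ-left-left (inj₂ j) (inj₁ i) rewrite pos-left-lower i | pos-left-upper j =
    trans (<ᵇ-false (ℕₚ.<⇒≤ (lower<left-upper i j))) (sym (<ᵇ-false (ℕₚ.<⇒≤ (lower<upper i j))))
  <ᵇ-left-left (inj₂ j) (inj₂ j') rewrite pos-left-upper j | pos-left-upper j' =
    trans (cong₂ _<ᵇ_ (ℕₚ.+-comm (pos {k₁} {l₁} (inj₂ j)) (k₂ ℕ.+ l₂)) (ℕₚ.+-comm (pos {k₁} {l₁} (inj₂ j')) (k₂ ℕ.+ l₂)))
          (<ᵇ-+ˡ (k₂ ℕ.+ l₂) _ _)

  <ᵇ-right-right : ∀ g y → (pos (rightPt g) <ᵇ pos (rightPt y)) ≡ (pos g <ᵇ pos y)
  <ᵇ-right-right g y rewrite pos-right g | pos-right y = <ᵇ-+ˡ k₁ _ _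

  <ᵇ-right-left : ∀ g x → (pos (rightPt g) <ᵇ pos (leftPt x)) ≡ isUpper x
  <ᵇ-right-left g (inj₁ i) rewrite pos-right g | pos-left-lower i =
    <ᵇ-false (ℕₚ.≤-trans (ℕₚ.<⇒≤ (Finₚ.toℕ<n i)) (ℕₚ.m≤m+n k₁ _))
  <ᵇ-right-left g (inj₂ j) rewrite pos-right g | pos-left-upper j = <ᵇ-true (right<left-upper g j)

  <ᵇ-left-right : ∀ g y → (pos (leftPt g) <ᵇ pos (rightPt y)) ≡ not (isUpper g)
  <ᵇ-left-right (inj₁ i) y rewrite pos-right y | pos-left-lower i = <ᵇ-true (ℕₚ.<-≤-trans (Finₚ.toℕ<n i) (ℕₚ.m≤m+n k₁ _))
  <ᵇ-left-right (inj₂ j) y rewrite pos-right y | pos-left-upper j = <ᵇ-false (ℕₚ.<⇒≤ (right<left-upper y j))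

  inOpen-left : ∀ a b c → inOpen (leftPt a) (leftPt b) (leftPt c) ≡ inOpen a b c
  inOpen-left a b c rewrite <ᵇ-left-left a b | <ᵇ-left-left a c | <ᵇ-left-left c b = refl

  inOpen-right : ∀ a b c → inOpen (rightPt a) (rightPt b) (rightPt c) ≡ inOpen a b c
  inOpen-right a b c rewrite <ᵇ-right-right a b | <ᵇ-right-right a c | <ᵇ-right-right c b = refl

  Σ-⊗ : Σp (p ⊗ q) ≡ Σp p + Σp q
  Σ-⊗ = begin
    Σp (p ⊗ q)                                                         ≡⟨ Σ-as-sum (p ⊗ q) ⟩
    sumPts K L (wt (p ⊗ q))                                            ≡⟨ sumPts-⊗ (wt (p ⊗ q)) ⟩
    sumPts k₁ l₁ (wt (p ⊗ q) ∘ leftPt) + sumPts k₂ l₂ (wt (p ⊗ q) ∘ rightPt)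
      ≡⟨ cong₂ _+_ (sumPts-cong (cong weight ∘ normCol-left)) (sumPts-cong (cong weight ∘ normCol-right)) ⟩
    sumPts k₁ l₁ (wt p) + sumPts k₂ l₂ (wt q)                          ≡⟨ cong₂ _+_ (sym (Σ-as-sum p)) (sym (Σ-as-sum q)) ⟩
    Σp p + Σp q                                                        ∎

  height-left : ∀ x → height (p ⊗ q) (leftPt x) ≡ height p x + ind (isUpper x) * Σp q
  height-left x = begin
    prefix (p ⊗ q) (pos (leftPt x)) + offset (normCol (p ⊗ q) (leftPt x))
      ≡⟨ cong₂ _+_ (sumPts-⊗ (weightBelow (p ⊗ q) (pos (leftPt x)))) (cong offset (normCol-left x)) ⟩
    sumPts k₁ l₁ (weightBelow (p ⊗ q) (pos (leftPt x)) ∘ leftPt) + sumPts k₂ l₂ (weightBelow (p ⊗ q) (pos (leftPt x)) ∘ rightPt) + offset (normCol p x)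
      ≡⟨ cong (_+ offset (normCol p x)) (cong₂ _+_
           (sumPts-cong (λ g → cong₂ _*_ (cong ind (<ᵇ-left-left g x)) (cong weight (normCol-left g))))
           (trans (sumPts-cong (λ g → cong₂ _*_ (cong ind (<ᵇ-right-left g x)) (cong weight (normCol-right g))))
                  (trans (sumℤ-map-*ˡ (ind (isUpper x)) (wt q) (allPts k₂ l₂)) (cong (_*_ (ind (isUpper x))) (sym (Σ-as-sum q)))))) ⟩
    prefix p (pos x) + ind (isUpper x) * Σp q + offset (normCol p x)
      ≡⟨ trans (ℤₚ.+-assoc (prefix p (pos x)) _ _) (ℤ+.x∙yz≈xz∙y (prefix p (pos x)) _ _) ⟩
    height p x + ind (isUpper x) * Σp q ∎

  lowerWeight : ℤ
  lowerWeight = sumPts k₁ l₁ (λ g → ind (not (isUpper g)) * wt p g)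

  height-right : ∀ y → height (p ⊗ q) (rightPt y) ≡ height q y + lowerWeight
  height-right y = begin
    prefix (p ⊗ q) (pos (rightPt y)) + offset (normCol (p ⊗ q) (rightPt y))
      ≡⟨ cong₂ _+_ (sumPts-⊗ (weightBelow (p ⊗ q) (pos (rightPt y)))) (cong offset (normCol-right y)) ⟩
    sumPts k₁ l₁ (weightBelow (p ⊗ q) (pos (rightPt y)) ∘ leftPt) + sumPts k₂ l₂ (weightBelow (p ⊗ q) (pos (rightPt y)) ∘ rightPt) + offset (normCol q y)
      ≡⟨ cong (_+ offset (normCol q y)) (cong₂ _+_
           (sumPts-cong (λ g → cong₂ _*_ (cong ind (<ᵇ-left-right g y)) (cong weight (normCol-left g))))
           (sumPts-cong (λ g → cong₂ _*_ (cong ind (<ᵇ-right-right g y)) (cong weight (normCol-right g))))) ⟩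
    lowerWeight + prefix q (pos y) + offset (normCol q y)
      ≡⟨ trans (ℤₚ.+-assoc lowerWeight (prefix q (pos y)) _) (ℤ+.x∙yz≈yz∙x lowerWeight (prefix q (pos y)) _) ⟩
    height q y + lowerWeight ∎

  cross-left⁻ : ∀ {x₁ x₂} → Cross (p ⊗ q) (leftPt x₁) (leftPt x₂) → Cross p x₁ x₂
  cross-left⁻ {x₁} {x₂} (c₁≁c₂ , b₁ , b₂ , c₁~b₁ , c₂~b₂ , c₁≢b₁ , c₂≢b₂ , c₂∈ , b₂∈)
    with same-side-left {x₁} {b₁} c₁~b₁ | same-side-left {x₂} {b₂} c₂~b₂
  ... | y₁ , refl | y₂ , refl =
    c₁≁c₂ ∘ ~-left x₁ x₂ , y₁ , y₂ , ~-left⁻ x₁ y₁ c₁~b₁ , ~-left⁻ x₂ y₂ c₂~b₂ ,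
    c₁≢b₁ ∘ cong leftPt , c₂≢b₂ ∘ cong leftPt ,
    trans (sym (inOpen-left x₁ y₁ x₂)) c₂∈ , trans (sym (inOpen-left y₁ x₁ y₂)) b₂∈

  cross-right⁻ : ∀ {x₁ x₂} → Cross (p ⊗ q) (rightPt x₁) (rightPt x₂) → Cross q x₁ x₂
  cross-right⁻ {x₁} {x₂} (c₁≁c₂ , b₁ , b₂ , c₁~b₁ , c₂~b₂ , c₁≢b₁ , c₂≢b₂ , c₂∈ , b₂∈)
    with same-side-right {x₁} {b₁} c₁~b₁ | same-side-right {x₂} {b₂} c₂~b₂
  ... | y₁ , refl | y₂ , refl =
    c₁≁c₂ ∘ ~-right x₁ x₂ , y₁ , y₂ , ~-right⁻ x₁ y₁ c₁~b₁ , ~-right⁻ x₂ y₂ c₂~b₂ ,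
    c₁≢b₁ ∘ cong rightPt , c₂≢b₂ ∘ cong rightPt ,
    trans (sym (inOpen-right x₁ y₁ x₂)) c₂∈ , trans (sym (inOpen-right y₁ x₁ y₂)) b₂∈

  -- all points of q lie on one side of any chord of p, so the arc test cannot tell them apart
  left-right-no-cross : ∀ {x y} → ¬ Cross (p ⊗ q) (leftPt x) (rightPt y)
  left-right-no-cross {x} {y} cr with cross⇒arcs (p ⊗ q) cr
  ... | b₁ , b₂ , x~b₁ , y~b₂ , y-inside , b₂-outside with same-side-left {x} {b₁} x~b₁ | same-side-right {y} {b₂} y~b₂
  ... | x' , refl | y' , refl = case trans (sym y-inside) (trans same-arc b₂-outside) of λ ()
    where
    same-arc : arc (pos (leftPt x)) (pos (leftPt x')) (pos (rightPt y)) ≡ arc (pos (leftPt x)) (pos (leftPt x')) (pos (rightPt y'))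
    same-arc = arc-same-side (pos (leftPt x)) (pos (leftPt x')) (pos (rightPt y)) (pos (rightPt y'))
      (trans (<ᵇ-left-right x y) (sym (<ᵇ-left-right x y'))) (trans (<ᵇ-right-left y x') (sym (<ᵇ-right-left y' x')))

  right-left-no-cross : ∀ {x y} → ¬ Cross (p ⊗ q) (rightPt y) (leftPt x)
  right-left-no-cross {x} {y} cr with cross⇒arcs (p ⊗ q) cr
  ... | b₁ , b₂ , y~b₁ , x~b₂ , x-inside , b₂-outside with same-side-right {y} {b₁} y~b₁ | same-side-left {x} {b₂} x~b₂
  ... | y' , refl | x' , refl = case trans (sym x-inside) (trans same-arc b₂-outside) of λ ()
    where
    straddles : ∀ z → (pos (rightPt y) <ᵇ pos (leftPt z)) xor (pos (leftPt z) <ᵇ pos (rightPt y')) ≡ true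
    straddles z rewrite <ᵇ-right-left y z | <ᵇ-left-right z y' with isUpper z
    ... | true = refl
    ... | false = refl
    same-arc : arc (pos (rightPt y)) (pos (rightPt y')) (pos (leftPt x)) ≡ arc (pos (rightPt y)) (pos (rightPt y')) (pos (leftPt x'))
    same-arc = arc-cong (pos (rightPt y)) (pos (rightPt y')) (pos (leftPt x)) (pos (leftPt x')) (trans (straddles x) (sym (straddles x')))

-- Composition

module Composition {k l r : ℕ} (p : Partition k l) (q : Partition l r)
                   (colours-match : ∀ j → upperCol p j ≡ lowerCol q j) where

  private
    C : Partition k r
    C = compose p q
    u : Fin l → Bool
    u = upperCol p

  lowerWeight : ℤ
  lowerWeight = sumFin k (wt p ∘ inj₁)

  middleWeight : ℤ
  middleWeight = sumFin l (weight ∘ u)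

  Δ : ℤ
  Δ = lowerWeight - middleWeight

  -- heights of p and heights of q shifted by Δ agree on the middle row (height-middle),
  -- so they glue to a height on all points of the composition picture
  midHeight : MidPt k l r → ℤ
  midHeight (inj₁ i) = height p (inj₁ i)
  midHeight (inj₂ (inj₁ j)) = height p (inj₂ j)
  midHeight (inj₂ (inj₂ i)) = height q (inj₂ i) + Δ

  private
    lower<k+ : ∀ {n} (i : Fin k) → toℕ i < k ℕ.+ n
    lower<k+ i = ℕₚ.<-≤-trans (Finₚ.toℕ<n i) (ℕₚ.m≤m+n k _)

    mid<l+ : ∀ {n} (j : Fin l) → toℕ j < l ℕ.+ n
    mid<l+ j = ℕₚ.<-≤-trans (Finₚ.toℕ<n j) (ℕₚ.m≤m+n l _)

    prefixBelow : Fin l → ℤ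
    prefixBelow j = sumFin l (λ j' → ind (toℕ j' <ᵇ toℕ j) * weight (u j'))

  height-p-middle : ∀ j → height p (inj₂ j) ≡
    lowerWeight + sumFin l (λ j' → ind (toℕ j <ᵇ toℕ j') * (- weight (u j'))) + offset (not (u j))
  height-p-middle j = cong (_+ offset (not (u j))) (trans (sumPts-split k l _) (cong₂ _+_
    (sumFin-ind-true k (wt p ∘ inj₁) (λ i → <ᵇ-true (lower<k+ i)))
    (sumFin-cong l (λ j' → cong₂ _*_ (cong ind (trans (<ᵇ-+ˡ k _ _) (<ᵇ-opposite j' j))) (weight-not (u j'))))))

  height-q-middle : ∀ j → height q (inj₁ j) ≡ prefixBelow j + offset (u j)
  height-q-middle j = cong₂ _+_
    (trans (sumPts-split l r _) (trans (cong₂ _+_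
       (sumFin-cong l (λ j' → cong (λ c → ind (toℕ j' <ᵇ toℕ j) * weight c) (sym (colours-match j'))))
       (sumFin-ind-false r (wt q ∘ inj₂) (λ i → <ᵇ-false (ℕₚ.<⇒≤ (mid<l+ j)))))
       (ℤₚ.+-identityʳ (prefixBelow j))))
    (cong offset (sym (colours-match j)))

  height-middle : ∀ j → height p (inj₂ j) ≡ height q (inj₁ j) + Δ
  height-middle j = begin
    height p (inj₂ j)
      ≡⟨ height-p-middle j ⟩
    lowerWeight + sumFin l (λ j' → ind (toℕ j <ᵇ toℕ j') * (- weight (u j'))) + offset (not (u j))
      ≡⟨ cong (λ s → lowerWeight + s + offset (not (u j))) (begin
          sumFin l (λ j' → ind (toℕ j <ᵇ toℕ j') * (- weight (u j')))
            ≡⟨ sumFin-cong l (λ j' → flip (toℕ j') (weight (u j'))) ⟩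
          sumFin l (λ j' → ind (toℕ j' <ᵇ toℕ j) * weight (u j') + ind (toℕ j' ≡ᵇ toℕ j) * weight (u j') - weight (u j'))
            ≡⟨ trans (sumℤ-map-minus _ (weight ∘ u) (allFin l)) (cong (_- middleWeight)
                 (trans (sumℤ-map-+ _ _ (allFin l)) (cong (_+_ (prefixBelow j)) (sumFin-delta l toℕ Finₚ.toℕ-injective (weight ∘ u) j)))) ⟩
          prefixBelow j + weight (u j) - middleWeight ∎) ⟩
    lowerWeight + (prefixBelow j + weight (u j) - middleWeight) + offset (not (u j))
      ≡⟨ regroup lowerWeight middleWeight (prefixBelow j) (weight (u j)) (offset (not (u j))) ⟩
    prefixBelow j + (weight (u j) + offset (not (u j))) + Δ
      ≡⟨ cong (λ o → prefixBelow j + o + Δ) (weight+offset-not (u j)) ⟩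
    prefixBelow j + offset (u j) + Δ
      ≡⟨ cong (_+ Δ) (sym (height-q-middle j)) ⟩
    height q (inj₁ j) + Δ ∎
    where
    flip : ∀ Y w → ind (toℕ j <ᵇ Y) * (- w) ≡ ind (Y <ᵇ toℕ j) * w + ind (Y ≡ᵇ toℕ j) * w - w
    flip Y w = trans (cong (λ i → i * (- w)) (ind-<ᵇ-flip (toℕ j) Y)) (distrib (ind (Y <ᵇ toℕ j)) (ind (Y ≡ᵇ toℕ j)) w)
      where distrib : ∀ s t w → (+ 1 - s - t) * (- w) ≡ s * w + t * w - w
            distrib = solve-∀
    regroup : ∀ L M S w o → L + (S + w - M) + o ≡ S + (w + o) + (L - M)
    regroup = solve-∀

  midHeight-fromP : ∀ x → midHeight (fromP x) ≡ height p x
  midHeight-fromP (inj₁ i) = refl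
  midHeight-fromP (inj₂ j) = refl

  midHeight-fromQ : ∀ y → midHeight (fromQ y) ≡ height q y + Δ
  midHeight-fromQ (inj₁ j) = height-middle j
  midHeight-fromQ (inj₂ i) = refl

  height-compose : ∀ a → height C a ≡ midHeight (outer a)
  height-compose (inj₁ i) = cong (_+ offset (lowerCol p i)) (trans (sumPts-split k r _) (trans
    (cong (_+_ (lowerPrefix i)) (sumFin-ind-false r (wt q ∘ inj₂) (λ i' → <ᵇ-false (ℕₚ.<⇒≤ (lower<k+ i)))))
    (sym (trans (sumPts-split k l _) (cong (_+_ (lowerPrefix i)) (sumFin-ind-false l (wt p ∘ inj₂) (λ j → <ᵇ-false (ℕₚ.<⇒≤ (lower<k+ i)))))))))
    where
    lowerPrefix : Fin k → ℤ
    lowerPrefix i = sumFin k (λ i' → ind (toℕ i' <ᵇ toℕ i) * wt p (inj₁ i'))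
  height-compose (inj₂ i) = begin
    prefix C (pos {k} {r} (inj₂ i)) + o
      ≡⟨ cong (_+ o) (trans (sumPts-split k r _) (cong₂ _+_
           (sumFin-ind-true k (wt p ∘ inj₁) (λ i' → <ᵇ-true (lower<k+ i')))
           (sumFin-cong r (λ i' → cong (λ b → ind b * wt q (inj₂ i')) (<ᵇ-+ˡ k _ _))))) ⟩
    lowerWeight + upperPrefix + o
      ≡⟨ regroup lowerWeight middleWeight upperPrefix o ⟩
    (middleWeight + upperPrefix + o) + Δ
      ≡⟨ cong (_+ Δ) (sym (cong (_+ o) (trans (sumPts-split l r _) (cong₂ _+_
           (trans (sumFin-ind-true l (wt q ∘ inj₁) (λ j → <ᵇ-true (mid<l+ j)))
                  (sumFin-cong l (λ j → cong weight (sym (colours-match j)))))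
           (sumFin-cong r (λ i' → cong (λ b → ind b * wt q (inj₂ i')) (<ᵇ-+ˡ l _ _))))))) ⟩
    height q (inj₂ i) + Δ ∎
    where
    o upperPrefix : ℤ
    o = offset (not (upperCol q i))
    upperPrefix = sumFin r (λ i' → ind (toℕ (opposite i') <ᵇ toℕ (opposite i)) * wt q (inj₂ i'))
    regroup : ∀ L M U o → L + U + o ≡ (M + U + o) + (L - M)
    regroup = solve-∀

  Σ-compose : Σp C ≡ Σp p + Σp q
  Σ-compose = begin
    Σp C
      ≡⟨ trans (Σ-as-sum C) (sumPts-split k r (wt C)) ⟩
    lowerWeight + upperWeight
      ≡⟨ regroup lowerWeight middleWeight upperWeight ⟩
    (lowerWeight + - middleWeight) + (middleWeight + upperWeight)
      ≡⟨ cong₂ _+_ (cong (_+_ lowerWeight) (sym (trans (sumFin-cong l (weight-not ∘ u)) (sumℤ-map-neg (weight ∘ u) (allFin l)))))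
                   (cong (_+ upperWeight) (sumFin-cong l (cong weight ∘ colours-match))) ⟩
    (lowerWeight + sumFin l (wt p ∘ inj₂)) + (sumFin l (wt q ∘ inj₁) + upperWeight)
      ≡⟨ cong₂ _+_ (sym (trans (Σ-as-sum p) (sumPts-split k l (wt p)))) (sym (trans (Σ-as-sum q) (sumPts-split l r (wt q)))) ⟩
    Σp p + Σp q ∎
    where
    upperWeight : ℤ
    upperWeight = sumFin r (wt q ∘ inj₂)
    regroup : ∀ L M U → L + U ≡ (L + - M) + (M + U)
    regroup = solve-∀

parity : List Bool → Bool
parity = foldr _xor_ false

module _ {A : Set} where

  parity-map-xor : ∀ (f g : A → Bool) xs → parity (map (λ x → f x xor g x) xs) ≡ parity (map f xs) xor parity (map g xs)
  parity-map-xor f g [] = refl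
  parity-map-xor f g (x ∷ xs) = trans (cong (_xor_ (f x xor g x)) (parity-map-xor f g xs)) (lemma (f x) (g x) _ _)
    where lemma : ∀ a b c d → (a xor b) xor (c xor d) ≡ (a xor c) xor (b xor d)
          lemma = BoolSolver.solve-∀ booleanRing

  parity-map-cong : ∀ {f g : A → Bool} xs → (∀ x → x ∈ xs → f x ≡ g x) → parity (map f xs) ≡ parity (map g xs)
  parity-map-cong [] f≗g = refl
  parity-map-cong (x ∷ xs) f≗g = cong₂ _xor_ (f≗g x (here refl)) (parity-map-cong xs (λ y y∈ → f≗g y (there y∈)))

  parity-map-false : ∀ {f : A → Bool} xs → (∀ x → x ∈ xs → f x ≡ false) → parity (map f xs) ≡ false
  parity-map-false [] f≗false = refl
  parity-map-false (x ∷ xs) f≗false rewrite f≗false x (here refl) = parity-map-false xs (λ y y∈ → f≗false y (there y∈))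

xor-telescope : ∀ a b c → (a xor b) xor (b xor c) ≡ a xor c
xor-telescope = BoolSolver.solve-∀ booleanRing

xor-false⇒≡ : ∀ {a b} → a xor b ≡ false → a ≡ b
xor-false⇒≡ {true} {true} _ = refl
xor-false⇒≡ {false} {false} _ = refl

-- Chords of the composition drawn on a line: the points of p first, then those of q,
-- so that every middle point j appears twice, at midP j and at midQ j.
module CompositionChords {k l r : ℕ} (p : Partition k l) (q : Partition l r) where

  _≈_ : MidPt k l r → MidPt k l r → Set
  _≈_ = EqClosure (CompEdge p q)

  posQ : Pt l r → ℕ
  posQ y = (k ℕ.+ l) ℕ.+ pos y

  linePos : MidPt k l r → ℕ
  linePos (inj₁ i) = toℕ i
  linePos (inj₂ (inj₁ j)) = pos {k} {l} (inj₂ j)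
  linePos (inj₂ (inj₂ i)) = posQ (inj₂ i)

  midP midQ : Fin l → ℕ
  midP j = pos {k} {l} (inj₂ j)
  midQ j = posQ (inj₁ j)

  mid : Fin l → MidPt k l r
  mid j = inj₂ (inj₁ j)

  data Chord : Set where
    p-chord : (x y : Pt k l) → _~_ p x y → Chord
    q-chord : (x y : Pt l r) → _~_ q x y → Chord

  start end : Chord → ℕ
  start (p-chord x _ _) = pos x
  start (q-chord x _ _) = posQ x
  end (p-chord _ y _) = pos y
  end (q-chord _ y _) = posQ y

  startPt endPt : Chord → MidPt k l r
  startPt (p-chord x _ _) = fromP x
  startPt (q-chord x _ _) = fromQ x
  endPt (p-chord _ y _) = fromP y
  endPt (q-chord _ y _) = fromQ y

  chordOf : ∀ {a b} → CompEdge p q a b → Chord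
  chordOf (edgeP {x} {y} x~y) = p-chord x y x~y
  chordOf (edgeQ {x} {y} x~y) = q-chord x y x~y

  chordOf-ends : ∀ {a b} (e : CompEdge p q a b) → startPt (chordOf e) ≡ a × endPt (chordOf e) ≡ b
  chordOf-ends (edgeP _) = refl , refl
  chordOf-ends (edgeQ _) = refl , refl

  chords : ∀ {s t} → s ≈ t → List Chord
  chords ε = []
  chords (fwd e ◅ path) = chordOf e ∷ chords path
  chords (bwd e ◅ path) = chordOf e ∷ chords path

  edge : ∀ {a b} → CompEdge p q a b → a ≈ b
  edge e = fwd e ◅ ε

  chords-in-block : ∀ {s t} (path : s ≈ t) c → c ∈ chords path → s ≈ startPt c × s ≈ endPt c
  chords-in-block (fwd e ◅ path) c (here refl) with startPt (chordOf e) | endPt (chordOf e) | chordOf-ends e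
  ... | _ | _ | refl , refl = ε , edge e
  chords-in-block (bwd e ◅ path) c (here refl) with startPt (chordOf e) | endPt (chordOf e) | chordOf-ends e
  ... | _ | _ | refl , refl = bwd e ◅ ε , ε
  chords-in-block (fwd e ◅ path) c (there c∈) = map× (fwd e ◅_) (fwd e ◅_) (chords-in-block path c c∈)
  chords-in-block (bwd e ◅ path) c (there c∈) = map× (bwd e ◅_) (bwd e ◅_) (chords-in-block path c c∈)

  data LiesAt : MidPt k l r → ℕ → Set where
    at-p : ∀ x {n} → pos x ≡ n → LiesAt (fromP x) n
    at-q : ∀ y {n} → posQ y ≡ n → LiesAt (fromQ y) n

  p<q : ∀ (x : Pt k l) (y : Pt l r) → pos x < posQ y
  p<q x y = ℕₚ.<-≤-trans (pos<k+l x) (ℕₚ.m≤m+n (k ℕ.+ l) _)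

  liesAt-injective : ∀ {z w n} → LiesAt z n → LiesAt w n → z ≡ w
  liesAt-injective (at-p x refl) (at-p x' eq) = cong fromP (pos-injective (sym eq))
  liesAt-injective (at-q y refl) (at-q y' eq) = cong fromQ (pos-injective (ℕₚ.+-cancelˡ-≡ (k ℕ.+ l) _ _ (sym eq)))
  liesAt-injective (at-p x refl) (at-q y eq) = ⊥-elim (ℕₚ.<-irrefl (sym eq) (p<q x y))
  liesAt-injective (at-q y refl) (at-p x eq) = ⊥-elim (ℕₚ.<-irrefl eq (p<q x y))

  start-liesAt : ∀ c → LiesAt (startPt c) (start c)
  start-liesAt (p-chord x _ _) = at-p x refl
  start-liesAt (q-chord x _ _) = at-q x refl

  end-liesAt : ∀ c → LiesAt (endPt c) (end c)
  end-liesAt (p-chord _ y _) = at-p y refl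
  end-liesAt (q-chord _ y _) = at-q y refl

  outer-liesAt : ∀ a → LiesAt (outer a) (linePos (outer a))
  outer-liesAt (inj₁ i) = at-p (inj₁ i) refl
  outer-liesAt (inj₂ i) = at-q (inj₂ i) refl

  chord-parity : ∀ (f : ℕ → Bool) {s a b} → (∀ j → s ≈ mid j → f (midP j) ≡ f (midQ j)) →
    s ≈ a → s ≈ b → (e : CompEdge p q a b) →
    f (start (chordOf e)) xor f (end (chordOf e)) ≡ f (linePos a) xor f (linePos b)
  chord-parity f _ _ _ (edgeP {x} {y} _) = cong₂ _xor_ (cong f (linePos-fromP x)) (cong f (linePos-fromP y))
    where
    linePos-fromP : ∀ x → pos x ≡ linePos (fromP {k} {l} {r} x)
    linePos-fromP (inj₁ _) = refl
    linePos-fromP (inj₂ _) = refl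
  chord-parity f {s} f-mid s≈a s≈b (edgeQ {x} {y} _) = cong₂ _xor_ (linePos-fromQ x s≈a) (linePos-fromQ y s≈b)
    where
    linePos-fromQ : ∀ z → s ≈ fromQ z → f (posQ z) ≡ f (linePos (fromQ z))
    linePos-fromQ (inj₁ j) s≈j = sym (f-mid j s≈j)
    linePos-fromQ (inj₂ _) _ = refl

  -- Summing f(start) xor f(end) over the chords of a path telescopes, as long as f
  -- does not distinguish the two copies of the middle points met along the way.
  telescope : ∀ (f : ℕ → Bool) {s t} (path : s ≈ t) → (∀ j → s ≈ mid j → f (midP j) ≡ f (midQ j)) →
    parity (map (λ c → f (start c) xor f (end c)) (chords path)) ≡ f (linePos s) xor f (linePos t)
  telescope f {s} ε _ = sym (Boolₚ.xor-same (f (linePos s)))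
  telescope f {s} {t} (_◅_ {j = v} (fwd e) path) f-mid =
    trans (cong₂ _xor_ (chord-parity f f-mid ε (edge e) e) (telescope f path (λ j v≈j → f-mid j (fwd e ◅ v≈j))))
          (xor-telescope (f (linePos s)) (f (linePos v)) (f (linePos t)))
  telescope f {s} {t} (_◅_ {j = v} (bwd e) path) f-mid =
    trans (cong₂ _xor_ (trans (chord-parity f f-mid (bwd e ◅ ε) ε e) (Boolₚ.xor-comm (f (linePos v)) (f (linePos s))))
                       (telescope f path (λ j v≈j → f-mid j (bwd e ◅ v≈j))))
          (xor-telescope (f (linePos s)) (f (linePos v)) (f (linePos t)))

  private
    k+l≤posQ : ∀ y → k ℕ.+ l ≤ posQ y
    k+l≤posQ y = ℕₚ.m≤m+n (k ℕ.+ l) _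

    midP<k+l : ∀ j → midP j < k ℕ.+ l
    midP<k+l j = pos<k+l (inj₂ j)

    k≤midP : ∀ j → k ≤ midP j
    k≤midP j = pos-upper j

    midQ<k+l+l : ∀ j → midQ j < k ℕ.+ l ℕ.+ l
    midQ<k+l+l j = ℕₚ.+-monoʳ-< (k ℕ.+ l) (Finₚ.toℕ<n j)

    k+l+l≤upper : ∀ i → k ℕ.+ l ℕ.+ l ≤ posQ (inj₂ i)
    k+l+l≤upper i = ℕₚ.+-monoʳ-≤ (k ℕ.+ l) (pos-upper {l} {r} i)

    midP<midQ : ∀ j j' → midP j < midQ j'
    midP<midQ j j' = ℕₚ.<-≤-trans (midP<k+l j) (k+l≤posQ (inj₁ j'))

    OutsideMiddle : ℕ → Set
    OutsideMiddle x = x < k ⊎ k ℕ.+ l ℕ.+ l ≤ x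

    outer-outside : ∀ a → OutsideMiddle (linePos (outer a))
    outer-outside (inj₁ i) = inj₁ (Finₚ.toℕ<n i)
    outer-outside (inj₂ i) = inj₂ (k+l+l≤upper i)

    below-middle : ∀ {x} j → OutsideMiddle x → (x <ᵇ midP j) ≡ (x <ᵇ midQ j)
    below-middle j (inj₁ x<k) =
      trans (<ᵇ-true (ℕₚ.<-≤-trans x<k (k≤midP j))) (sym (<ᵇ-true (ℕₚ.<-≤-trans x<k (ℕₚ.≤-trans (ℕₚ.m≤m+n k l) (k+l≤posQ (inj₁ j))))))
    below-middle j (inj₂ k+l+l≤x) =
      trans (<ᵇ-false (ℕₚ.≤-trans (ℕₚ.<⇒≤ (ℕₚ.<-trans (midP<midQ j j) (midQ<k+l+l j))) k+l+l≤x))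
            (sym (<ᵇ-false (ℕₚ.≤-trans (ℕₚ.<⇒≤ (midQ<k+l+l j)) k+l+l≤x)))

    above-middle : ∀ {x} j → OutsideMiddle x → (midP j <ᵇ x) ≡ (midQ j <ᵇ x)
    above-middle j (inj₁ x<k) =
      trans (<ᵇ-false (ℕₚ.≤-trans (ℕₚ.<⇒≤ x<k) (k≤midP j)))
            (sym (<ᵇ-false (ℕₚ.≤-trans (ℕₚ.<⇒≤ x<k) (ℕₚ.≤-trans (ℕₚ.m≤m+n k l) (k+l≤posQ (inj₁ j))))))
    above-middle j (inj₂ k+l+l≤x) =
      trans (<ᵇ-true (ℕₚ.<-≤-trans (ℕₚ.<-trans (midP<midQ j j) (midQ<k+l+l j)) k+l+l≤x))
            (sym (<ᵇ-true (ℕₚ.<-≤-trans (midQ<k+l+l j) k+l+l≤x)))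

  <ᵇ-outer : ∀ a b → (linePos (outer a) <ᵇ linePos (outer b)) ≡ (pos a <ᵇ pos b)
  <ᵇ-outer (inj₁ i) (inj₁ i') = refl
  <ᵇ-outer (inj₁ i) (inj₂ j) =
    trans (<ᵇ-true (ℕₚ.<-≤-trans (Finₚ.toℕ<n i) (ℕₚ.≤-trans (ℕₚ.m≤m+n k l) (k+l≤posQ (inj₂ j)))))
          (sym (<ᵇ-true (lower<upper i j)))
  <ᵇ-outer (inj₂ j) (inj₁ i) =
    trans (<ᵇ-false (ℕₚ.<⇒≤ (ℕₚ.<-≤-trans (Finₚ.toℕ<n i) (ℕₚ.≤-trans (ℕₚ.m≤m+n k l) (k+l≤posQ (inj₂ j))))))
          (sym (<ᵇ-false (ℕₚ.<⇒≤ (lower<upper i j))))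
  <ᵇ-outer (inj₂ j) (inj₂ j') = trans (<ᵇ-+ˡ (k ℕ.+ l) _ _) (trans (<ᵇ-+ˡ l _ _) (sym (<ᵇ-+ˡ k _ _)))

  arc-outer : ∀ a b c → arc (linePos (outer a)) (linePos (outer b)) (linePos (outer c)) ≡ arc (pos a) (pos b) (pos c)
  arc-outer a b c rewrite <ᵇ-outer a c | <ᵇ-outer c b | <ᵇ-outer a b = refl

  outer∉middle-arc : ∀ j a → arc (midP j) (midQ j) (linePos (outer a)) ≡ false
  outer∉middle-arc j a rewrite <ᵇ-true (midP<midQ j j) with outer-outside a
  ... | inj₁ x<k rewrite <ᵇ-false (ℕₚ.≤-trans (ℕₚ.<⇒≤ x<k) (k≤midP j))
                       | <ᵇ-true (ℕₚ.<-≤-trans x<k (ℕₚ.≤-trans (ℕₚ.m≤m+n k l) (k+l≤posQ (inj₁ j)))) = refl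
  ... | inj₂ k+l+l≤x rewrite <ᵇ-true (ℕₚ.<-≤-trans (ℕₚ.<-trans (midP<midQ j j) (midQ<k+l+l j)) k+l+l≤x)
                           | <ᵇ-false (ℕₚ.≤-trans (ℕₚ.<⇒≤ (midQ<k+l+l j)) k+l+l≤x) = refl

  middle-arc-copies : ∀ j j' → arc (midP j) (midQ j) (midP j') ≡ arc (midP j) (midQ j) (midQ j')
  middle-arc-copies j j' = arc-cong (midP j) (midQ j) (midP j') (midQ j')
    (trans (cong₂ _xor_ (trans (<ᵇ-+ˡ k _ _) (<ᵇ-opposite j j')) (<ᵇ-true (midP<midQ j' j)))
      (trans (Boolₚ.xor-comm (toℕ j' <ᵇ toℕ j) true)
        (sym (cong₂ _xor_ (<ᵇ-true (midP<midQ j j')) (<ᵇ-+ˡ (k ℕ.+ l) (toℕ j') (toℕ j))))))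

  outer-arc-copies : ∀ a b j → arc (linePos (outer a)) (linePos (outer b)) (midP j) ≡ arc (linePos (outer a)) (linePos (outer b)) (midQ j)
  outer-arc-copies a b j = arc-same-side (linePos (outer a)) (linePos (outer b)) (midP j) (midQ j) (below-middle j (outer-outside a)) (above-middle j (outer-outside b))

  crosses : Chord → Chord → Bool
  crosses c d = arc (start d) (end d) (start c) xor arc (start d) (end d) (end c)

  p-chord-misses-q-chord : ∀ {x y x' y'} (x~y : _~_ p x y) (x'~y' : _~_ q x' y') →
    crosses (p-chord x y x~y) (q-chord x' y' x'~y') ≡ false
  p-chord-misses-q-chord {x} {y} {x'} {y'} _ _ =
    trans (cong (_xor arc (posQ x') (posQ y') (pos y)) (arc-cong (posQ x') (posQ y') (pos x) (pos y)
            (trans (arc-outside (inj₁ (p<q x x' , p<q x y'))) (sym (arc-outside (inj₁ (p<q y x' , p<q y y')))))))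
          (Boolₚ.xor-same (arc (posQ x') (posQ y') (pos y)))

  q-chord-misses-p-chord : ∀ {x y x' y'} (x~y : _~_ q x y) (x'~y' : _~_ p x' y') →
    crosses (q-chord x y x~y) (p-chord x' y' x'~y') ≡ false
  q-chord-misses-p-chord {x} {y} {x'} {y'} _ _ =
    trans (cong (_xor arc (pos x') (pos y') (posQ y)) (arc-cong (pos x') (pos y') (posQ x) (posQ y)
            (trans (arc-outside (inj₂ (p<q x' x , p<q y' x))) (sym (arc-outside (inj₂ (p<q x' y , p<q y' y)))))))
          (Boolₚ.xor-same (arc (pos x') (pos y') (posQ y)))

module Multiples (m : ℕ) where

  mℤ-zero : InMZ m (+ 0)
  mℤ-zero = + 0 , sym (ℤₚ.*-zeroʳ (+ m))

  mℤ-+ : ∀ {x y} → InMZ m x → InMZ m y → InMZ m (x + y)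
  mℤ-+ (s , refl) (t , refl) = s + t , sym (ℤₚ.*-distribˡ-+ (+ m) s t)

  mℤ-neg : ∀ {x} → InMZ m x → InMZ m (- x)
  mℤ-neg (s , refl) = - s , ℤₚ.neg-distribʳ-* (+ m) s

  mℤ-*ˡ : ∀ c {x} → InMZ m x → InMZ m (c * x)
  mℤ-*ˡ c (s , refl) = c * s , lemma c (+ m) s
    where lemma : ∀ a b c → a * (b * c) ≡ b * (a * c)
          lemma = solve-∀

  mℤ? : ∀ z → Dec (InMZ m z)
  mℤ? z with + m DS.∣? z
  ... | yes (DS.divides q eq) = yes (q , trans eq (ℤₚ.*-comm q (+ m)))
  ... | no ∤z = no (λ { (t , eq) → ∤z (DS.divides t (trans eq (ℤₚ.*-comm (+ m) t))) })

infix 4 _≡_mod_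
record _≡_mod_ (x y : ℤ) (m : ℕ) : Set where
  constructor ≡mod
  field difference : InMZ m (y - x)
open _≡_mod_

module _ {m : ℕ} where
  open Multiples m

  ≡mod-refl : ∀ x → x ≡ x mod m
  ≡mod-refl x = ≡mod (subst (InMZ m) (sym (ℤₚ.+-inverseʳ x)) mℤ-zero)

  ≡mod-sym : ∀ {x y} → x ≡ y mod m → y ≡ x mod m
  ≡mod-sym {x} {y} (≡mod d) = ≡mod (subst (InMZ m) (lemma x y) (mℤ-neg d))
    where lemma : ∀ x y → - (y - x) ≡ x - y
          lemma = solve-∀

  ≡mod-trans : ∀ {x y z} → x ≡ y mod m → y ≡ z mod m → x ≡ z mod m
  ≡mod-trans {x} {y} {z} (≡mod d) (≡mod d') = ≡mod (subst (InMZ m) (lemma x y z) (mℤ-+ d d'))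
    where lemma : ∀ x y z → (y - x) + (z - y) ≡ z - x
          lemma = solve-∀

  ≡mod-+ : ∀ {x x' y y'} → x ≡ x' mod m → y ≡ y' mod m → x + y ≡ x' + y' mod m
  ≡mod-+ {x} {x'} {y} {y'} (≡mod d) (≡mod d') = ≡mod (subst (InMZ m) (lemma x x' y y') (mℤ-+ d d'))
    where lemma : ∀ x x' y y' → (x' - x) + (y' - y) ≡ x' + y' - (x + y)
          lemma = solve-∀

  ≡mod-neg : ∀ {x x'} → x ≡ x' mod m → - x ≡ - x' mod m
  ≡mod-neg {x} {x'} (≡mod d) = ≡mod (subst (InMZ m) (lemma x x') (mℤ-neg d))
    where lemma : ∀ x x' → - (x' - x) ≡ - x' - - x
          lemma = solve-∀

  ≡mod-minus : ∀ {x x' y y'} → x ≡ x' mod m → y ≡ y' mod m → x - y ≡ x' - y' mod m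
  ≡mod-minus x≡x' y≡y' = ≡mod-+ x≡x' (≡mod-neg y≡y')

  ≡mod-+ʳ-mℤ : ∀ x {y} → InMZ m y → x ≡ x + y mod m
  ≡mod-+ʳ-mℤ x {y} y∈mℤ = ≡mod (subst (InMZ m) (lemma x y) y∈mℤ)
    where lemma : ∀ x y → y ≡ x + y - x
          lemma = solve-∀


  mℤ-resp-≡mod : ∀ {x y} → x ≡ y mod m → InMZ m x → InMZ m y
  mℤ-resp-≡mod {x} {y} (≡mod d) x∈ = subst (InMZ m) (lemma x y) (mℤ-+ x∈ d)
    where lemma : ∀ x y → x + (y - x) ≡ y
          lemma = solve-∀

  ≡mod-stable : ∀ {x y} → ¬ ¬ (x ≡ y mod m) → x ≡ y mod m
  ≡mod-stable {x} {y} ¬¬x≡y = ≡mod (decidable-stable (mℤ? (y - x)) (λ ∉ → ¬¬x≡y (∉ ∘ difference)))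

-- Admissible partitions

module Admissibility (m : ℕ) (E : ℤ → Set)
  (E-neg : ∀ {z} → E z → E (- z))
  (E-mod : ∀ {z w} → z ≡ w mod m → E z → E w) where

  open Multiples m

  record Admissible {k l} (p : Partition k l) : Set where
    field
      Σ-mℤ : InMZ m (Σp p)
      height-block : ∀ {a b} → _~_ p a b → height p a ≡ height p b mod m
      height-cross : ∀ {a b} → Cross p a b → ¬ E (height p b - height p a)

  module _ {k l} (p : Partition k l) where
    private
      module ~ = IsEquivalence (isEquiv p)

    δ≡height-difference : InMZ m (Σp p) → ∀ {a b} → a ≢ b → height p b - height p a ≡ δ p a b mod m
    δ≡height-difference Σ∈ {a} {b} a≢b =
      subst (λ z → height p b - height p a ≡ z mod m) (sym (δ-height p a≢b))
            (≡mod-+ʳ-mℤ _ (mℤ-*ˡ (ind (not (pos a <ᵇ pos b))) Σ∈))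

    Admissible⇒R : Admissible p → R (Qm m E) p
    Admissible⇒R adm = block-nonempty , (λ _ _ → tt) , (λ { _ refl → Σ-mℤ }) ,
                       (λ { _ (_ , _ , nb , _ , refl) → neighbours nb }) ,
                       (λ { _ (_ , _ , nb , _ , refl) → neighbours nb }) ,
                       (λ { _ (_ , _ , _ , _ , cr , c₁~a₁ , c₂~a₂ , refl) → crossing cr c₁~a₁ c₂~a₂ })
      where
      open Admissible adm
      block-nonempty : ∀ n → FSet p n → 1 ≤ n
      block-nonempty n (a , [] , (_ , mem) , _) = case Equivalence.from (mem a) ~.refl of λ ()
      block-nonempty n (a , _ ∷ _ , _ , refl) = s≤s z≤n
      neighbours : ∀ {a b} → Neighbours p a b → InMZ m (δ p a b)
      neighbours (a~b , a≢b , _) = mℤ-resp-≡mod (δ≡height-difference Σ-mℤ a≢b) (difference (height-block a~b))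
      crossing : ∀ {c₁ c₂ a₁ a₂} → Cross p c₁ c₂ → _~_ p c₁ a₁ → _~_ p c₂ a₂ → ¬ E (δ p a₁ a₂)
      crossing {c₁} {c₂} {a₁} {a₂} cr c₁~a₁ c₂~a₂ Eδ = height-cross cr (E-mod shift Eδ)
        where
        a₁≢a₂ : a₁ ≢ a₂
        a₁≢a₂ refl = proj₁ cr (~.trans c₁~a₁ (~.sym c₂~a₂))
        shift : δ p a₁ a₂ ≡ height p c₂ - height p c₁ mod m
        shift = ≡mod-trans (≡mod-sym (δ≡height-difference Σ-mℤ a₁≢a₂))
                  (≡mod-minus (≡mod-sym (height-block c₂~a₂)) (≡mod-sym (height-block c₁~a₁)))

    private
      StrictlyBetween : Pt k l → Pt k l → Set
      StrictlyBetween a b = ∃[ g ] (pos a < pos g × pos g < pos b × _~_ p a g)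

      nothing-between⇒open-free : ∀ {a b} → pos a < pos b → ¬ StrictlyBetween a b →
        ∀ g → inOpen a b g ≡ true → ¬ _~_ p a g
      nothing-between⇒open-free {a} {b} a<b none g g∈ a~g rewrite <ᵇ-true a<b
        with pos a <ᵇ pos g in a<g | pos g <ᵇ pos b in g<b
      ... | true | true = none (g , <ᵇ-true⇒< a<g , <ᵇ-true⇒< g<b , a~g)
      ... | true | false = case g∈ of λ ()
      ... | false | _ = case g∈ of λ ()

    -- Only ¬¬ of "some point of the block lies strictly between a and b" is available,
    -- since blocks need not be decidable; the decidability of mℤ-membership absorbs it.
    height-along-block : InMZ m (Σp p) → (∀ {a b} → Neighbours p a b → InMZ m (δ p a b)) →
      ∀ n {a b} → pos a < pos b → pos b ≤ pos a ℕ.+ n → _~_ p a b → height p a ≡ height p b mod m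
    height-along-block Σ∈ nb zero {a} {b} a<b b≤a _ =
      ⊥-elim (ℕₚ.<⇒≱ a<b (subst (pos b ≤_) (ℕₚ.+-identityʳ (pos a)) b≤a))
    height-along-block Σ∈ nb (suc n) {a} {b} a<b b≤a+n a~b =
      ≡mod-stable λ ¬goal → ¬¬-excluded-middle (¬goal ∘ by-cases)
      where
      by-cases : Dec (StrictlyBetween a b) → height p a ≡ height p b mod m
      by-cases (yes (g , a<g , g<b , a~g)) =
        ≡mod-trans (height-along-block Σ∈ nb n a<g g≤a+n a~g)
                   (height-along-block Σ∈ nb n g<b b≤g+n (~.trans (~.sym a~g) a~b))
        where
        g≤a+n : pos g ≤ pos a ℕ.+ n
        g≤a+n = ℕₚ.≤-pred (ℕₚ.<-≤-trans g<b (subst (pos b ≤_) (ℕₚ.+-suc (pos a) n) b≤a+n))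
        b≤g+n : pos b ≤ pos g ℕ.+ n
        b≤g+n = ℕₚ.≤-trans (subst (pos b ≤_) (ℕₚ.+-suc (pos a) n) b≤a+n) (ℕₚ.+-monoˡ-≤ n a<g)
      by-cases (no none) = ≡mod (mℤ-resp-≡mod (≡mod-sym (δ≡height-difference Σ∈ a≢b))
                                   (nb (a~b , a≢b , nothing-between⇒open-free {a} {b} a<b none)))
        where
        a≢b : a ≢ b
        a≢b refl = ℕₚ.<-irrefl refl a<b

    R⇒Admissible : R (Qm m E) p → Admissible p
    R⇒Admissible (_ , _ , Σ-cond , L-cond , K-cond , X-cond) = record
      { Σ-mℤ = Σ∈ ; height-block = block ; height-cross = cross }
      where
      Σ∈ : InMZ m (Σp p)
      Σ∈ = Σ-cond _ refl
      neighbours : ∀ {a b} → Neighbours p a b → InMZ m (δ p a b)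
      neighbours {a} {b} nb with σL p (a ∷ b ∷ []) ℤₚ.≟ + 0
      ... | yes σ≡0 = K-cond _ (a , b , nb , σ≡0 , refl)
      ... | no σ≢0 = L-cond _ (a , b , nb , σ≢0 , refl)
      block : ∀ {a b} → _~_ p a b → height p a ≡ height p b mod m
      block {a} {b} a~b with ℕₚ.<-cmp (pos a) (pos b)
      ... | tri< a<b _ _ = height-along-block Σ∈ neighbours (pos b) a<b (ℕₚ.m≤n+m (pos b) (pos a)) a~b
      ... | tri≈ _ a≡b _ rewrite pos-injective {a = a} {b} a≡b = ≡mod-refl (height p b)
      ... | tri> _ _ b<a = ≡mod-sym (height-along-block Σ∈ neighbours (pos a) b<a (ℕₚ.m≤n+m (pos a) (pos b)) (~.sym a~b))
      cross : ∀ {a b} → Cross p a b → ¬ E (height p b - height p a)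
      cross {a} {b} cr E-diff =
        X-cond _ (a , b , a , b , cr , ~.refl , ~.refl , refl) (E-mod (δ≡height-difference Σ∈ a≢b) E-diff)
        where
        a≢b : a ≢ b
        a≢b refl = proj₁ cr ~.refl

  private
    one-block : ∀ {k l} (p : Partition k l) → Σp p ≡ + 0 → (∀ a b → height p a ≡ height p b) →
      (∀ a b → _~_ p a b) → Admissible p
    one-block p Σ≡0 height-constant all-related = record
      { Σ-mℤ = subst (InMZ m) (sym Σ≡0) mℤ-zero
      ; height-block = λ {a} {b} _ → subst (height p a ≡_mod m) (height-constant a b) (≡mod-refl (height p a))
      ; height-cross = λ {a} {b} cr → ⊥-elim (proj₁ cr (all-related a b))
      }

  admissible-empty : Admissible emptyP
  admissible-empty = record
    { Σ-mℤ = mℤ-zero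
    ; height-block = λ { {inj₁ ()} ; {inj₂ ()} }
    ; height-cross = λ { {inj₁ ()} ; {inj₂ ()} }
    }

  admissible-id : ∀ c → Admissible (idP c)
  admissible-id c = one-block (idP c) (Σ≡0 c) (height-constant c) (λ _ _ → tt)
    where
    Σ≡0 : ∀ c → Σp (idP c) ≡ + 0
    Σ≡0 true = refl
    Σ≡0 false = refl
    height-constant : ∀ c a b → height (idP c) a ≡ height (idP c) b
    height-constant true (inj₁ Fin.zero) (inj₁ Fin.zero) = refl
    height-constant true (inj₁ Fin.zero) (inj₂ Fin.zero) = refl
    height-constant true (inj₂ Fin.zero) (inj₁ Fin.zero) = refl
    height-constant true (inj₂ Fin.zero) (inj₂ Fin.zero) = refl
    height-constant false (inj₁ Fin.zero) (inj₁ Fin.zero) = refl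
    height-constant false (inj₁ Fin.zero) (inj₂ Fin.zero) = refl
    height-constant false (inj₂ Fin.zero) (inj₁ Fin.zero) = refl
    height-constant false (inj₂ Fin.zero) (inj₂ Fin.zero) = refl

  admissible-pair : ∀ c → Admissible (pairP c (not c))
  admissible-pair c = one-block (pairP c (not c)) (Σ≡0 c) (height-constant c) (λ _ _ → tt)
    where
    Σ≡0 : ∀ c → Σp (pairP c (not c)) ≡ + 0
    Σ≡0 true = refl
    Σ≡0 false = refl
    height-constant : ∀ c a b → height (pairP c (not c)) a ≡ height (pairP c (not c)) b
    height-constant true (inj₁ Fin.zero) (inj₁ Fin.zero) = refl
    height-constant true (inj₁ Fin.zero) (inj₁ (Fin.suc Fin.zero)) = refl
    height-constant true (inj₁ (Fin.suc Fin.zero)) (inj₁ Fin.zero) = refl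
    height-constant true (inj₁ (Fin.suc Fin.zero)) (inj₁ (Fin.suc Fin.zero)) = refl
    height-constant false (inj₁ Fin.zero) (inj₁ Fin.zero) = refl
    height-constant false (inj₁ Fin.zero) (inj₁ (Fin.suc Fin.zero)) = refl
    height-constant false (inj₁ (Fin.suc Fin.zero)) (inj₁ Fin.zero) = refl
    height-constant false (inj₁ (Fin.suc Fin.zero)) (inj₁ (Fin.suc Fin.zero)) = refl

  admissible-* : ∀ {k l} (p : Partition k l) → Admissible p → Admissible (p *)
  admissible-* p adm = record
    { Σ-mℤ = subst (InMZ m) (sym (Σ-* p)) (mℤ-neg Σ-mℤ)
    ; height-block = λ {a} {b} a~b →
        subst₂ (_≡_mod m) (sym (height-* p a)) (sym (height-* p b)) (≡mod-minus (height-block a~b) (≡mod-refl (Σp p)))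
    ; height-cross = cross
    }
    where
    open Admissible adm
    difference-* : ∀ a b → height (p *) b - height (p *) a ≡ height p (swapPt b) - height p (swapPt a)
    difference-* a b = trans (cong₂ _-_ (height-* p b) (height-* p a)) (cancel (height p (swapPt b)) (height p (swapPt a)) (Σp p))
      where cancel : ∀ x y s → (x - s) - (y - s) ≡ x - y
            cancel = solve-∀
    cross : ∀ {a b} → Cross (p *) a b → ¬ E (height (p *) b - height (p *) a)
    cross {a} {b} cr E-diff with cross-* p cr
    ... | b' , b~b' , cr' = height-cross cr' (E-mod shift E-diff)
      where
      shift : height (p *) b - height (p *) a ≡ height p (swapPt b') - height p (swapPt a) mod m
      shift = subst (_≡ height p (swapPt b') - height p (swapPt a) mod m) (sym (difference-* a b))
                    (≡mod-minus (height-block b~b') (≡mod-refl (height p (swapPt a))))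

  admissible-⊗ : ∀ {k₁ l₁ k₂ l₂} (p : Partition k₁ l₁) (q : Partition k₂ l₂) →
    Admissible p → Admissible q → Admissible (p ⊗ q)
  admissible-⊗ p q adm-p adm-q = record
    { Σ-mℤ = subst (InMZ m) (sym Σ-⊗) (mℤ-+ P.Σ-mℤ Q.Σ-mℤ)
    ; height-block = λ {a} {b} → block {a} {b}
    ; height-cross = λ {a} {b} → cross {a} {b}
    }
    where
    open Tensor p q
    module P = Admissible adm-p
    module Q = Admissible adm-q
    module ~ = IsEquivalence (isEquiv (p ⊗ q))

    height-left-≡ : ∀ x → height p x ≡ height (p ⊗ q) (leftPt x) mod m
    height-left-≡ x = subst (height p x ≡_mod m) (sym (height-left x)) (≡mod-+ʳ-mℤ _ (mℤ-*ˡ (ind (isUpper x)) Q.Σ-mℤ))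

    height-right-≡ : ∀ {x y} → height q x ≡ height q y mod m →
      height (p ⊗ q) (rightPt x) ≡ height (p ⊗ q) (rightPt y) mod m
    height-right-≡ {x} {y} x≡y =
      subst₂ (_≡_mod m) (sym (height-right x)) (sym (height-right y)) (≡mod-+ x≡y (≡mod-refl lowerWeight))

    block : ∀ {a b} → _~_ (p ⊗ q) a b → height (p ⊗ q) a ≡ height (p ⊗ q) b mod m
    block {a} {b} a~b with left-or-right a | left-or-right b
    ... | inj₁ (x , refl) | inj₁ (y , refl) =
      ≡mod-trans (≡mod-sym (height-left-≡ x)) (≡mod-trans (P.height-block (~-left⁻ x y a~b)) (height-left-≡ y))
    ... | inj₁ (x , refl) | inj₂ (y , refl) = ⊥-elim (left≁right x y a~b)
    ... | inj₂ (x , refl) | inj₁ (y , refl) = ⊥-elim (left≁right y x (~.sym {rightPt x} {leftPt y} a~b))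
    ... | inj₂ (x , refl) | inj₂ (y , refl) = height-right-≡ {x} {y} (Q.height-block (~-right⁻ x y a~b))

    cross : ∀ {a b} → Cross (p ⊗ q) a b → ¬ E (height (p ⊗ q) b - height (p ⊗ q) a)
    cross {a} {b} cr with left-or-right a | left-or-right b
    ... | inj₁ (x , refl) | inj₁ (y , refl) =
      P.height-cross (cross-left⁻ cr) ∘ E-mod (≡mod-minus (≡mod-sym (height-left-≡ y)) (≡mod-sym (height-left-≡ x)))
    ... | inj₂ (x , refl) | inj₂ (y , refl) =
      Q.height-cross (cross-right⁻ cr) ∘ subst E right-difference
      where
      right-difference : height (p ⊗ q) (rightPt y) - height (p ⊗ q) (rightPt x) ≡ height q y - height q x
      right-difference = trans (cong₂ _-_ (height-right y) (height-right x)) (cancel (height q y) (height q x) lowerWeight)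
        where cancel : ∀ a b c → (a + c) - (b + c) ≡ a - b
              cancel = solve-∀
    ... | inj₁ (x , refl) | inj₂ (y , refl) = ⊥-elim (left-right-no-cross cr)
    ... | inj₂ (x , refl) | inj₁ (y , refl) = ⊥-elim (right-left-no-cross cr)

  module _ {k l r : ℕ} (p : Partition k l) (q : Partition l r) (colours-match : ∀ j → upperCol p j ≡ lowerCol q j)
           (adm-p : Admissible p) (adm-q : Admissible q) where
    private
      module P = Admissible adm-p
      module Q = Admissible adm-q
      C : Partition k r
      C = compose p q
    open Composition p q colours-match
    open CompositionChords p q

    midHeight-edge : ∀ {a b} → CompEdge p q a b → midHeight a ≡ midHeight b mod m
    midHeight-edge (edgeP {x} {y} x~y) =
      subst₂ (_≡_mod m) (sym (midHeight-fromP x)) (sym (midHeight-fromP y)) (P.height-block x~y)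
    midHeight-edge (edgeQ {x} {y} x~y) =
      subst₂ (_≡_mod m) (sym (midHeight-fromQ x)) (sym (midHeight-fromQ y)) (≡mod-+ (Q.height-block x~y) (≡mod-refl Δ))

    midHeight-block : ∀ {s t} → s ≈ t → midHeight s ≡ midHeight t mod m
    midHeight-block {s} ε = ≡mod-refl (midHeight s)
    midHeight-block (fwd e ◅ path) = ≡mod-trans (midHeight-edge e) (midHeight-block path)
    midHeight-block (bwd e ◅ path) = ≡mod-trans (≡mod-sym (midHeight-edge e)) (midHeight-block path)

    -- Parity argument: the chords of the block of c₁ and of the block of c₂ would have to
    -- cross an odd number of times (they separate c₂ from b₂ along the outer circle),
    -- yet two chords from the same factor cannot cross, and chords from different factors never do.
    module CrossingArgument {c₁ c₂ b₁ b₂ : Pt k r} (c₁≁c₂ : ¬ _~_ C c₁ c₂)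
      (c₁~b₁ : _~_ C c₁ b₁) (c₂~b₂ : _~_ C c₂ b₂)
      (c₂-inside : arc (pos c₁) (pos b₁) (pos c₂) ≡ true) (b₂-outside : arc (pos c₁) (pos b₁) (pos b₂) ≡ false)
      (E-diff : E (height C c₂ - height C c₁)) where

      private
        s₁ s₂ : MidPt k l r
        s₁ = outer c₁
        s₂ = outer c₂
        XS YS : List Chord
        XS = chords c₁~b₁
        YS = chords c₂~b₂

      blocks-disjoint : ∀ {z} → s₁ ≈ z → s₂ ≈ z → ⊥
      blocks-disjoint s₁≈z s₂≈z = c₁≁c₂ (s₁≈z ◅◅ EqC.symmetric (CompEdge p q) s₂≈z)

      positions-differ : ∀ {z w n n'} → LiesAt z n → LiesAt w n' → s₁ ≈ z → s₂ ≈ w → n ≢ n'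
      positions-differ z-at w-at s₁≈z s₂≈w refl =
        blocks-disjoint s₁≈z (subst (s₂ ≈_) (sym (liesAt-injective z-at w-at)) s₂≈w)

      E-between : ∀ {z w} → s₁ ≈ z → s₂ ≈ w → E (midHeight z - midHeight w)
      E-between s₁≈z s₂≈w = E-mod (≡mod-minus (midHeight-block s₁≈z) (midHeight-block s₂≈w))
        (subst E (trans (negate (height C c₂) (height C c₁)) (cong₂ _-_ (height-compose c₁) (height-compose c₂)))
               (E-neg E-diff))
        where negate : ∀ a b → - (a - b) ≡ b - a
              negate = solve-∀

      factor-chords-do-not-cross : ∀ {k' l'} (p' : Partition k' l') → Admissible p' →
        (ι : Pt k' l' → MidPt k l r) → (∀ {x y} → _~_ p' x y → CompEdge p q (ι x) (ι y)) →
        (c : ℤ) → (∀ x → midHeight (ι x) ≡ height p' x + c) →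
        ∀ {x y x' y'} → _~_ p' x y → _~_ p' x' y' → s₁ ≈ ι x → s₂ ≈ ι x' →
        arc (pos x') (pos y') (pos x) xor arc (pos x') (pos y') (pos y) ≡ false
      factor-chords-do-not-cross p' adm ι ι-edge c height-ι {x} {y} {x'} {y'} x~y x'~y' s₁≈x s₂≈x'
        with arc (pos x') (pos y') (pos x) xor arc (pos x') (pos y') (pos y) in odd
      ... | false = refl
      ... | true with arcs⇒cross p' x'~y' x~y x'≁x odd
        where
        x'≁x : ¬ _~_ p' x' x
        x'≁x x'~x = blocks-disjoint s₁≈x (s₂≈x' ◅◅ edge (ι-edge x'~x))
      ... | z , x~z , cr = ⊥-elim (Admissible.height-cross adm cr (subst E heights (E-between (s₁≈x ◅◅ edge (ι-edge x~z)) s₂≈x')))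
        where
        heights : midHeight (ι z) - midHeight (ι x') ≡ height p' z - height p' x'
        heights = trans (cong₂ _-_ (height-ι z) (height-ι x')) (cancel (height p' z) (height p' x') c)
          where cancel : ∀ a b c → (a + c) - (b + c) ≡ a - b
                cancel = solve-∀

      chords-do-not-cross : ∀ c → c ∈ XS → ∀ d → d ∈ YS → crosses c d ≡ false
      chords-do-not-cross (p-chord x y x~y) c∈ (p-chord x' y' x'~y') d∈ =
        factor-chords-do-not-cross p adm-p fromP edgeP (+ 0) (λ z → trans (midHeight-fromP z) (sym (ℤₚ.+-identityʳ _)))
          x~y x'~y' (proj₁ (chords-in-block c₁~b₁ _ c∈)) (proj₁ (chords-in-block c₂~b₂ _ d∈))
      chords-do-not-cross (q-chord x y x~y) c∈ (q-chord x' y' x'~y') d∈ =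
        trans (cong₂ _xor_ (arc-+ˡ (k ℕ.+ l) (pos x') (pos y') (pos x)) (arc-+ˡ (k ℕ.+ l) (pos x') (pos y') (pos y)))
          (factor-chords-do-not-cross q adm-q fromQ edgeQ Δ midHeight-fromQ
            x~y x'~y' (proj₁ (chords-in-block c₁~b₁ _ c∈)) (proj₁ (chords-in-block c₂~b₂ _ d∈)))
      chords-do-not-cross (p-chord _ _ x~y) _ (q-chord _ _ x'~y') _ = p-chord-misses-q-chord x~y x'~y'
      chords-do-not-cross (q-chord _ _ x~y) _ (p-chord _ _ x'~y') _ = q-chord-misses-p-chord x~y x'~y'

      crossings : Bool
      crossings = parity (map (λ c → parity (map (crosses c) YS)) XS)

      crossings-even : crossings ≡ false
      crossings-even = parity-map-false XS (λ c c∈ → parity-map-false YS (λ d d∈ → chords-do-not-cross c c∈ d d∈))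

      winding : ℕ → Bool
      winding z = parity (map (λ d → arc (start d) (end d) z) YS)

      winding-difference : ∀ A B → (∀ d → d ∈ YS → start d ≢ A) → (∀ d → d ∈ YS → end d ≢ B) →
        winding A xor winding B ≡ parity (map (λ d → arc A B (start d) xor arc A B (end d)) YS)
      winding-difference A B start≢A end≢B =
        trans (sym (parity-map-xor (λ d → arc (start d) (end d) A) (λ d → arc (start d) (end d) B) YS))
              (parity-map-cong YS (λ d d∈ → arc-symmetric (start d) (end d) A B (start≢A d d∈) (end≢B d d∈)))

      private
        start-avoids : ∀ {z n} → LiesAt z n → s₁ ≈ z → ∀ d → d ∈ YS → start d ≢ n
        start-avoids z-at s₁≈z d d∈ = positions-differ z-at (start-liesAt d) s₁≈z (proj₁ (chords-in-block c₂~b₂ d d∈)) ∘ sym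

        end-avoids : ∀ {z n} → LiesAt z n → s₁ ≈ z → ∀ d → d ∈ YS → end d ≢ n
        end-avoids z-at s₁≈z d d∈ = positions-differ z-at (end-liesAt d) s₁≈z (proj₂ (chords-in-block c₂~b₂ d d∈)) ∘ sym

      winding-copies : ∀ j → s₁ ≈ mid j → winding (midP j) ≡ winding (midQ j)
      winding-copies j s₁≈j = xor-false⇒≡ (begin
        winding (midP j) xor winding (midQ j)
          ≡⟨ winding-difference (midP j) (midQ j) (start-avoids (at-p (inj₂ j) refl) s₁≈j) (end-avoids (at-q (inj₁ j) refl) s₁≈j) ⟩
        parity (map (λ d → arc (midP j) (midQ j) (start d) xor arc (midP j) (midQ j) (end d)) YS)
          ≡⟨ telescope (arc (midP j) (midQ j)) c₂~b₂ (λ j' _ → middle-arc-copies j j') ⟩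
        arc (midP j) (midQ j) (linePos s₂) xor arc (midP j) (midQ j) (linePos (outer b₂))
          ≡⟨ cong₂ _xor_ (outer∉middle-arc j c₂) (outer∉middle-arc j b₂) ⟩
        false ∎)

      crossings-odd : crossings ≡ true
      crossings-odd = begin
        crossings
          ≡⟨ parity-map-cong XS (λ c _ → parity-map-xor (λ d → arc (start d) (end d) (start c)) (λ d → arc (start d) (end d) (end c)) YS) ⟩
        parity (map (λ c → winding (start c) xor winding (end c)) XS)
          ≡⟨ telescope winding c₁~b₁ winding-copies ⟩
        winding A xor winding B
          ≡⟨ winding-difference A B (start-avoids (outer-liesAt c₁) ε) (end-avoids (outer-liesAt b₁) c₁~b₁) ⟩
        parity (map (λ d → arc A B (start d) xor arc A B (end d)) YS)
          ≡⟨ telescope (arc A B) c₂~b₂ (λ j _ → outer-arc-copies c₁ b₁ j) ⟩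
        arc A B (linePos s₂) xor arc A B (linePos (outer b₂))
          ≡⟨ cong₂ _xor_ (trans (arc-outer c₁ b₁ c₂) c₂-inside) (trans (arc-outer c₁ b₁ b₂) b₂-outside) ⟩
        true ∎
        where
        A B : ℕ
        A = linePos s₁
        B = linePos (outer b₁)

      contradiction : ⊥
      contradiction = case trans (sym crossings-odd) crossings-even of λ ()

    admissible-compose : Admissible C
    admissible-compose = record
      { Σ-mℤ = subst (InMZ m) (sym Σ-compose) (mℤ-+ P.Σ-mℤ Q.Σ-mℤ)
      ; height-block = λ {a} {b} a~b →
          subst₂ (_≡_mod m) (sym (height-compose a)) (sym (height-compose b)) (midHeight-block a~b)
      ; height-cross = cross
      }
      where
      cross : ∀ {a b} → Cross C a b → ¬ E (height C b - height C a)
      cross cr E-diff with cross⇒arcs C cr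
      ... | b₁ , b₂ , a~b₁ , b~b₂ , inside , outside =
        CrossingArgument.contradiction (proj₁ cr) a~b₁ b~b₂ inside outside E-diff

lemma6p15 : (m : ℕ) (E : ℤ → Set) →
    (∀ z → E z ⇔ (∃[ e ] (E e × z ≡ - e))) →
    (∀ z → E z ⇔ (∃[ e ] ∃[ t ] (E e × z ≡ e + (+ m) * t))) →
    IsCategory (R (Qm m E))
lemma6p15 m E E-sym E-periodic = record
  { hasEmpty = Admissible⇒R emptyP admissible-empty
  ; hasId∘ = Admissible⇒R (idP true) (admissible-id true)
  ; hasId● = Admissible⇒R (idP false) (admissible-id false)
  ; hasPair●∘ = Admissible⇒R (pairP false true) (admissible-pair false)
  ; hasPair∘● = Admissible⇒R (pairP true false) (admissible-pair true)
  ; tensorClosed = λ p q Rp Rq → Admissible⇒R (p ⊗ q) (admissible-⊗ p q (R⇒Admissible p Rp) (R⇒Admissible q Rq))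
  ; involClosed = λ p Rp → Admissible⇒R (p *) (admissible-* p (R⇒Admissible p Rp))
  ; compClosed = λ p q match Rp Rq →
      Admissible⇒R (compose p q) (admissible-compose p q match (R⇒Admissible p Rp) (R⇒Admissible q Rq))
  }
  where
  E-neg : ∀ {z} → E z → E (- z)
  E-neg {z} Ez = Equivalence.from (E-sym (- z)) (z , Ez , refl)

  E-mod : ∀ {z w} → z ≡ w mod m → E z → E w
  E-mod {z} {w} (≡mod (t , w-z≡mt)) Ez =
    Equivalence.from (E-periodic w) (z , t , Ez , trans (lemma w z) (cong (_+_ z) w-z≡mt))
    where lemma : ∀ w z → w ≡ z + (w - z)
          lemma = solve-∀

  open Admissibility m E E-neg E-mod
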